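{- Let $n\ge1$, $m\ge2$, $1\le r\le m$. If $M$ is a perfect matching of $T(2n+1,2m,2r)$ consisting only of vertical edges, then by a sequence of flips starting from $M$ one can obtain $M_1$ or $M_2$, where $M_1=E_0\cup E_2\cup\cdots\cup E_{2m-2}$, $M_2=E_1\cup E_3\cup\cdots\cup E_{2m-1}$ and $E_j=\{v_{i,j}v_{i,j+1}: i\in Z_{2n+1}\}$.
   Context: Write $Z_k=\{0,\dots,k-1\}$. $T(N,K,R)$ is the graph with vertices $v_{i,j}$ ($i\in Z_N$, $j\in Z_K$, second index mod $K$), horizontal edges $v_{i,j}v_{i,j+1}$, and vertical edges $v_{i,j}v_{i+1,j}$ ($0\le i\le N-2$) and $v_{N-1,j}v_{0,j+R}$, embedded on the torus with faces $v_{i,j}v_{i,j+1}v_{i+1,j+1}v_{i+1,j}$ ($0\le i\le N-2$) and $v_{N-1,j}v_{N-1,j+1}v_{0,j+R+1}v_{0,j+R}$. A flip replaces a perfect matching $M$ by $M\oplus E(f)$ for a face $f$ whose boundary is $M$-alternating. -}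

module Defs where

open import Data.Nat using (ℕ; zero; suc; _+_; _<?_)
open import Data.Nat.DivMod using (_mod_)
open import Data.Fin using (Fin; zero; suc; toℕ; fromℕ<)
import Data.Fin.Properties as FinP
open import Data.Bool using (Bool; true; false; _∨_; _xor_; not)
open import Data.Product using (Σ; ∃; _×_; _,_; proj₁; proj₂)
open import Data.Sum using (_⊎_)
open import Relation.Nullary using (yes; no)
open import Relation.Nullary.Decidable using (⌊_⌋)
open import Relation.Binary.PropositionalEquality using (_≡_)
open import Relation.Binary.Construct.Closure.ReflexiveTransitive using (Star)

Vertex : ℕ → ℕ → Set
Vertex N K = Fin N × Fin K

addMod : ∀ {K} → Fin K → ℕ → Fin K
addMod {suc k} j r = (toℕ j + r) mod (suc k)

-- Other endpoint of the vertical edge at v_{i,j}: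
-- v_{i+1,j} if i ≤ N-2, and v_{0,j+R} if i = N-1.
vEnd : ∀ {N K} (R : ℕ) → Fin N → Fin K → Vertex N K
vEnd {suc n} R i j with suc (toℕ i) <? suc n
... | yes p = fromℕ< p , j
... | no _  = zero , addMod j R

-- Edges of T(N,K,R), labelled:
--   hor i j = v_{i,j} v_{i,j+1}
--   ver i j = v_{i,j} v_{i+1,j}  (resp. v_{N-1,j} v_{0,j+R})
data Edge (N K : ℕ) : Set where
  hor : Fin N → Fin K → Edge N K
  ver : Fin N → Fin K → Edge N K

endpoints : ∀ {N K} (R : ℕ) → Edge N K → Vertex N K × Vertex N K
endpoints R (hor i j) = (i , j) , (i , addMod j 1)
endpoints R (ver i j) = (i , j) , vEnd R i j

Incident : ∀ {N K} (R : ℕ) → Vertex N K → Edge N K → Set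
Incident R v e = (v ≡ proj₁ (endpoints R e)) ⊎ (v ≡ proj₂ (endpoints R e))

edgeEq : ∀ {N K} → Edge N K → Edge N K → Bool
edgeEq (hor i j) (hor i' j') = ⌊ i FinP.≟ i' ⌋ Data.Bool.∧ ⌊ j FinP.≟ j' ⌋
  where import Data.Bool
edgeEq (ver i j) (ver i' j') = ⌊ i FinP.≟ i' ⌋ Data.Bool.∧ ⌊ j FinP.≟ j' ⌋
  where import Data.Bool
edgeEq (hor _ _) (ver _ _) = false
edgeEq (ver _ _) (hor _ _) = false

EdgeSet : ℕ → ℕ → Set
EdgeSet N K = Edge N K → Bool

IsPerfectMatching : ∀ {N K} (R : ℕ) → EdgeSet N K → Set
IsPerfectMatching {N} {K} R M =
  (v : Vertex N K) → Σ (Edge N K) λ e →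
    (M e ≡ true) × Incident R v e ×
    ((e' : Edge N K) → M e' ≡ true → Incident R v e' → e' ≡ e)

-- Faces: the face indexed by (i , j) has boundary cycle
-- v_{i,j} v_{i,j+1} w' w  where w = vEnd R i j, w' = vEnd R i (j+1),
-- i.e. boundary edges, in cyclic order:
--   hor i j , ver i (j+1) , hor w , ver i j
Face : ℕ → ℕ → Set
Face N K = Fin N × Fin K

faceE₁ faceE₂ faceE₃ faceE₄ : ∀ {N K} (R : ℕ) → Face N K → Edge N K
faceE₁ R (i , j) = hor i j
faceE₂ R (i , j) = ver i (addMod j 1)
faceE₃ R (i , j) = hor (proj₁ (vEnd R i j)) (proj₂ (vEnd R i j))
faceE₄ R (i , j) = ver i j

inFace : ∀ {N K} (R : ℕ) → Face N K → Edge N K → Bool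
inFace R f e = edgeEq e (faceE₁ R f) ∨ edgeEq e (faceE₂ R f)
             ∨ edgeEq e (faceE₃ R f) ∨ edgeEq e (faceE₄ R f)

Alternating : ∀ {N K} (R : ℕ) → EdgeSet N K → Face N K → Set
Alternating R M f =
  (M (faceE₁ R f) ≡ true × M (faceE₂ R f) ≡ false ×
   M (faceE₃ R f) ≡ true × M (faceE₄ R f) ≡ false)
  ⊎
  (M (faceE₁ R f) ≡ false × M (faceE₂ R f) ≡ true ×
   M (faceE₃ R f) ≡ false × M (faceE₄ R f) ≡ true)

Flip : ∀ {N K} (R : ℕ) → EdgeSet N K → EdgeSet N K → Set
Flip {N} {K} R M M' = Σ (Face N K) λ f →
  Alternating R M f × ((e : Edge N K) → M' e ≡ (M e xor inFace R f e))

FlipReachable : ∀ {N K} (R : ℕ) → EdgeSet N K → EdgeSet N K → Set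
FlipReachable R = Star (Flip R)

_≗ₑ_ : ∀ {N K} → EdgeSet N K → EdgeSet N K → Set
_≗ₑ_ {N} {K} M M' = (e : Edge N K) → M e ≡ M' e

OnlyVertical : ∀ {N K} → EdgeSet N K → Set
OnlyVertical {N} {K} M = (i : Fin N) (j : Fin K) → M (hor i j) ≡ false

isEven : ℕ → Bool
isEven zero = true
isEven (suc k) = not (isEven k)

M₁ : ∀ {N K} → EdgeSet N K
M₁ (hor i j) = isEven (toℕ j)
M₁ (ver i j) = false

M₂ : ∀ {N K} → EdgeSet N K
M₂ (hor i j) = not (isEven (toℕ j))
M₂ (ver i j) = false

-- A vertical matching of T(N, K, R) with N odd is described by a column profile T : ℕ → Bool
-- (ver i j is taken iff i is even xor T j); following a vertical cycle through the wrap-around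
-- shows that T is K-periodic and R-antiperiodic, and a Bézout relation for g = 2 gcd(m, r) makes it
-- g-antiperiodic as well.  If T j = T (j + 1), the faces between the columns ≡ j and ≡ j + 1 (mod g)
-- whose left side is taken are pairwise edge-disjoint and alternating; flipping all of them and then
-- flipping back towards another vertical matching toggles T on those columns.  For ψ = T xor parity on
-- the window [0, g), such a toggle exchanges two unequal neighbours of ψ, or, across the twisted end of
-- the window, toggles the two ends of ψ when they agree.  So only the number of ones of ψ matters: the
-- end moves bring it to h or h + 1 (where g = 2h + 2), after which ψ is sorted into the alternating
-- pattern, i.e. T becomes constant on the first g - 1 columns.  One more pass of flips then yields M₁
-- or M₂.

module Submission where

open import Defs
open import Algebra.Bundles using (CommutativeRing)
open import Data.Nat using (ℕ; zero; suc; pred; _+_; _*_; _%_; _/_; _<_; _≤_; _≡ᵇ_; _<?_; z≤n; s≤s; s≤s⁻¹; NonZero)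
open import Data.Nat.Properties
open import Algebra.Properties.CommutativeSemigroup +-commutativeSemigroup
  using () renaming (xy∙z≈xz∙y to +-swapʳ; interchange to +-interchange)
open import Data.Nat.DivMod
  using (_mod_; m%n<n; m≡m%n+[m/n]*n; %-distribˡ-+; m%n%n≡m%n; [m+kn]%n≡m%n; [m+n]%n≡m%n; m<n⇒m%n≡m; n%n≡0)
open import Data.Nat.GCD using (gcd; gcd-GCD; gcd[m,n]∣m; gcd[m,n]∣n; gcd[m,n]≢0; module Bézout)
open import Data.Nat.Divisibility using (_∣_)
open import Data.Nat.Tactic.RingSolver using (solve-∀)
open import Data.Fin using (Fin; zero; suc; toℕ; fromℕ<; fromℕ; inject₁)
import Data.Fin.Properties as FinP
open import Data.Bool using (Bool; true; false; not; _∧_; _∨_; _xor_; T?)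
open import Data.Bool.Properties
  using ( xor-identityʳ; xor-assoc; xor-same; xor-comm; true-xor; xor-annihilates-not; not-distribˡ-xor
        ; not-distribʳ-xor; not-involutive; not-injective; ¬-not; not-¬; ∨-inverseʳ; ∧-zeroʳ; T-≡; xor-∧-commutativeRing)
  renaming (_≟_ to _≟ᵇ_)
open import Algebra.Properties.CommutativeSemigroup (CommutativeRing.+-commutativeSemigroup xor-∧-commutativeRing)
  using () renaming (xy∙z≈xz∙y to xor-swapʳ)
open import Data.Bool.ListAction using (any)
open import Data.Product using (Σ; _×_; _,_; proj₁; proj₂)
open import Data.Sum using (_⊎_; inj₁; inj₂)
import Data.Sum as Sum
open import Data.Empty using (⊥; ⊥-elim)
open import Data.List using (List; []; _∷_; cartesianProduct; allFin; filterᵇ)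
open import Data.List.Membership.Propositional using (_∈_; find; lose)
open import Data.List.Membership.Propositional.Properties using (∈-cartesianProduct⁺; ∈-allFin; ∈-filter⁺; ∈-filter⁻)
open import Data.List.Relation.Unary.Any using (here; there)
open import Data.List.Relation.Unary.Any.Properties using (any⁺; any⁻)
open import Data.List.Relation.Unary.All as All using (All; _∷_)
open import Data.List.Relation.Unary.AllPairs using (_∷_)
open import Data.List.Relation.Unary.Unique.Propositional using (Unique)
open import Data.List.Relation.Unary.Unique.Propositional.Properties using (cartesianProduct⁺; allFin⁺; filter⁺)
open import Function using (Equivalence; _∘_)
open import Relation.Nullary using (yes; no)
open import Relation.Nullary.Decidable using (⌊_⌋)
open import Relation.Binary.PropositionalEquality
open import Relation.Binary.Construct.Closure.ReflexiveTransitive using (ε; _◅_; _◅◅_; reverse)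

xor-true : ∀ b → b xor true ≡ not b
xor-true b = trans (xor-comm b true) (true-xor b)

xor-cancelʳ : ∀ a b → (a xor b) xor b ≡ a
xor-cancelʳ a b = trans (xor-assoc a b b) (trans (cong (a xor_) (xor-same b)) (xor-identityʳ a))

xor-∨-disjoint : ∀ a b c → (b ≡ true → c ≡ true → ⊥) → (a xor b) xor c ≡ a xor (b ∨ c)
xor-∨-disjoint a true true disjoint = ⊥-elim (disjoint refl refl)
xor-∨-disjoint a true false _ = xor-identityʳ (a xor true)
xor-∨-disjoint a false c _ = cong (_xor c) (xor-identityʳ a)

∨-introˡ : ∀ {a} b → a ≡ true → a ∨ b ≡ true
∨-introˡ b refl = refl

∨-introʳ : ∀ a {b} → b ≡ true → a ∨ b ≡ true
∨-introʳ true _ = refl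
∨-introʳ false p = p

∨-true : ∀ {a b} → a ∨ b ≡ true → a ≡ true ⊎ b ≡ true
∨-true {true} _ = inj₁ refl
∨-true {false} p = inj₂ p

∧-true : ∀ {a b} → a ∧ b ≡ true → a ≡ true × b ≡ true
∧-true {true} {true} _ = refl , refl

true-iff⇒≡ : ∀ {a b} → (a ≡ true → b ≡ true) → (b ≡ true → a ≡ true) → a ≡ b
true-iff⇒≡ {true} a⇒b _ = sym (a⇒b refl)
true-iff⇒≡ {false} {true} _ b⇒a = b⇒a refl
true-iff⇒≡ {false} {false} _ _ = refl

true≢false : true ≢ false
true≢false ()

xor-∧ : ∀ a b → a xor (a ∧ b) ≡ a ∧ not b
xor-∧ true true = refl
xor-∧ true false = refl
xor-∧ false b = refl

xor-∧-not : ∀ a b → (a xor b) ∧ not b ≡ a ∧ not b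
xor-∧-not a true = trans (∧-zeroʳ (a xor true)) (sym (∧-zeroʳ a))
xor-∧-not a false = cong (_∧ true) (xor-identityʳ a)

≡ᵇ-refl : ∀ n → (n ≡ᵇ n) ≡ true
≡ᵇ-refl n = Equivalence.to T-≡ (≡⇒≡ᵇ n n refl)

≡ᵇ-true : ∀ m n → (m ≡ᵇ n) ≡ true → m ≡ n
≡ᵇ-true m n p = ≡ᵇ⇒≡ m n (Equivalence.from T-≡ p)

≢⇒≡ᵇ-false : ∀ {m n} → m ≢ n → (m ≡ᵇ n) ≡ false
≢⇒≡ᵇ-false {m} {n} m≢n with m ≡ᵇ n in eq
... | false = refl
... | true = ⊥-elim (m≢n (≡ᵇ-true m n eq))

Periodic : ℕ → (ℕ → Bool) → Set
Periodic P T = ∀ x → T (x + P) ≡ T x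

Antiperiodic : ℕ → (ℕ → Bool) → Set
Antiperiodic P T = ∀ x → T (x + P) ≡ not (T x)

odd : ℕ → Bool
odd q = not (isEven q)

isEven-double : ∀ m → isEven (m + m) ≡ true
isEven-double zero = refl
isEven-double (suc m) = trans (cong (not ∘ isEven) (+-suc m m)) (trans (not-involutive _) (isEven-double m))

module _ {P : ℕ} {T : ℕ → Bool} where

  periodic-iterate : Periodic P T → ∀ x q → T (x + q * P) ≡ T x
  periodic-iterate per x zero = cong T (+-identityʳ x)
  periodic-iterate per x (suc q) =
    trans (cong T (sym (+-assoc x P (q * P)))) (trans (periodic-iterate per (x + P) q) (per x))

  periodic-mod : .{{_ : NonZero P}} → Periodic P T → ∀ x → T (x % P) ≡ T x
  periodic-mod per x = trans (sym (periodic-iterate per (x % P) (x / P))) (cong T (sym (m≡m%n+[m/n]*n x P)))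

  antiperiodic-iterate : Antiperiodic P T → ∀ x q → T (x + q * P) ≡ T x xor odd q
  antiperiodic-iterate anti x zero = trans (cong T (+-identityʳ x)) (sym (xor-identityʳ (T x)))
  antiperiodic-iterate anti x (suc q) = begin
    T (x + (P + q * P))      ≡⟨ cong T (sym (+-assoc x P (q * P))) ⟩
    T (x + P + q * P)        ≡⟨ antiperiodic-iterate anti (x + P) q ⟩
    T (x + P) xor odd q      ≡⟨ cong (_xor odd q) (anti x) ⟩
    not (T x) xor odd q      ≡⟨ not-distribˡ-xor (T x) (odd q) ⟨
    not (T x xor odd q)      ≡⟨ not-distribʳ-xor (T x) (odd q) ⟩
    T x xor odd (suc q)      ∎
    where open ≡-Reasoning

Alternates : (ℕ → Bool) → Set
Alternates X = ∀ x → X (suc x) ≡ not (X x)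

alternates-shift : ∀ {X} → Alternates X → ∀ x m → X (x + m) ≡ X x xor odd m
alternates-shift {X} alt x zero = trans (cong X (+-identityʳ x)) (sym (xor-identityʳ (X x)))
alternates-shift {X} alt x (suc m) = begin
  X (x + suc m)          ≡⟨ cong X (+-suc x m) ⟩
  X (suc (x + m))        ≡⟨ alt (x + m) ⟩
  not (X (x + m))        ≡⟨ cong not (alternates-shift alt x m) ⟩
  not (X x xor odd m)    ≡⟨ not-distribʳ-xor (X x) (odd m) ⟩
  X x xor odd (suc m)    ∎
  where open ≡-Reasoning

alternates-periodic : ∀ {X} → Alternates X → ∀ {P} → isEven P ≡ true → Periodic P X
alternates-periodic {X} alt {P} P-even x =
  trans (alternates-shift alt x P) (trans (cong (λ b → X x xor not b) P-even) (xor-identityʳ (X x)))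


antiperiodic-split : ∀ {P T} .{{_ : NonZero P}} → Antiperiodic P T →
                     ∀ d x → T (d + x) ≡ T (d + x % P) xor odd (x / P)
antiperiodic-split {P} {T} anti d x = begin
  T (d + x)                              ≡⟨ cong (λ y → T (d + y)) (m≡m%n+[m/n]*n x P) ⟩
  T (d + (x % P + x / P * P))            ≡⟨ cong T (sym (+-assoc d (x % P) (x / P * P))) ⟩
  T (d + x % P + x / P * P)              ≡⟨ antiperiodic-iterate anti (d + x % P) (x / P) ⟩
  T (d + x % P) xor odd (x / P)          ∎
  where open ≡-Reasoning

shift-by-gcd : ∀ {T K R g x y} → Periodic K T → Antiperiodic R T →
               (g + y * R ≡ x * K ⊎ g + x * K ≡ y * R) → ∀ z → T (z + g) ≡ T z xor odd y
shift-by-gcd {T} {K} {R} {g} {x} {y} per anti (inj₁ eq) z = begin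
  T (z + g)                          ≡⟨ xor-cancelʳ (T (z + g)) (odd y) ⟨
  (T (z + g) xor odd y) xor odd y    ≡⟨ cong (_xor odd y) (antiperiodic-iterate anti (z + g) y) ⟨
  T (z + g + y * R) xor odd y        ≡⟨ cong (λ w → T w xor odd y) (trans (+-assoc z g (y * R)) (cong (z +_) eq)) ⟩
  T (z + x * K) xor odd y            ≡⟨ cong (_xor odd y) (periodic-iterate per z x) ⟩
  T z xor odd y                      ∎
  where open ≡-Reasoning
shift-by-gcd {T} {K} {R} {g} {x} {y} per anti (inj₂ eq) z = begin
  T (z + g)                          ≡⟨ periodic-iterate per (z + g) x ⟨
  T (z + g + x * K)                  ≡⟨ cong T (trans (+-assoc z g (x * K)) (cong (z +_) eq)) ⟩
  T (z + y * R)                      ≡⟨ antiperiodic-iterate anti z y ⟩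
  T z xor odd y                      ∎
  where open ≡-Reasoning

-- y must be odd: for even y the shift by g, and hence by its multiple R, would be a period
antiperiodic-gcd : ∀ {T K R g b x y} → Periodic K T → Antiperiodic R T → R ≡ b * g →
                   (g + y * R ≡ x * K ⊎ g + x * K ≡ y * R) → Antiperiodic g T
antiperiodic-gcd {T} {K} {R} {g} {b} {x} {y} per anti R≡ bezout z
  with odd y | shift-by-gcd {T} {K} {R} {g} {x} {y} per anti bezout
... | true | shift = trans (shift z) (xor-true (T z))
... | false | shift = ⊥-elim (not-¬ {T 0} refl (trans (sym R-period) (anti 0)))
  where
    R-period : T R ≡ T 0
    R-period = trans (cong T R≡) (periodic-iterate (λ w → trans (shift w) (xor-identityʳ (T w))) 0 b)

bit : Bool → ℕ
bit true = 1
bit false = 0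

ones : ℕ → (ℕ → Bool) → ℕ
ones zero ψ = 0
ones (suc n) ψ = ones n ψ + bit (ψ n)

flipAt : ℕ → (ℕ → Bool) → ℕ → Bool
flipAt c ψ x = ψ x xor (x ≡ᵇ c)

flipAt-here : ∀ c ψ → flipAt c ψ c ≡ not (ψ c)
flipAt-here c ψ = trans (cong (ψ c xor_) (≡ᵇ-refl c)) (xor-true (ψ c))

flipAt-elsewhere : ∀ {c x} ψ → x ≢ c → flipAt c ψ x ≡ ψ x
flipAt-elsewhere {c} {x} ψ x≢c = trans (cong (ψ x xor_) (≢⇒≡ᵇ-false x≢c)) (xor-identityʳ (ψ x))

ones-cong : ∀ n {ψ ψ'} → (∀ x → x < n → ψ x ≡ ψ' x) → ones n ψ ≡ ones n ψ'
ones-cong zero _ = refl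
ones-cong (suc n) eq = cong₂ _+_ (ones-cong n (λ x x<n → eq x (m<n⇒m<1+n x<n))) (cong bit (eq n ≤-refl))

ones-flipAt-outside : ∀ n {c} ψ → n ≤ c → ones n (flipAt c ψ) ≡ ones n ψ
ones-flipAt-outside n ψ n≤c = ones-cong n λ x x<n → flipAt-elsewhere ψ (<⇒≢ (<-≤-trans x<n n≤c))

bit-not+bit : ∀ b → bit (not b) + bit b ≡ 1
bit-not+bit true = refl
bit-not+bit false = refl

ones-flipAt : ∀ n c ψ → c < n → ones n (flipAt c ψ) + bit (ψ c) ≡ ones n ψ + bit (not (ψ c))
ones-flipAt (suc n) c ψ c<1+n with m≤n⇒m<n∨m≡n (s≤s⁻¹ c<1+n)
... | inj₂ refl = begin
  ones c (flipAt c ψ) + bit (flipAt c ψ c) + bit (ψ c)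
    ≡⟨ cong (λ m → m + bit (flipAt c ψ c) + bit (ψ c)) (ones-flipAt-outside c ψ ≤-refl) ⟩
  ones c ψ + bit (flipAt c ψ c) + bit (ψ c)               ≡⟨ cong (λ b → ones c ψ + bit b + bit (ψ c)) (flipAt-here c ψ) ⟩
  ones c ψ + bit (not (ψ c)) + bit (ψ c)                  ≡⟨ +-swapʳ (ones c ψ) _ _ ⟩
  ones c ψ + bit (ψ c) + bit (not (ψ c))                  ∎
  where open ≡-Reasoning
... | inj₁ c<n = begin
  ones n (flipAt c ψ) + bit (flipAt c ψ n) + bit (ψ c)
    ≡⟨ cong (λ b → ones n (flipAt c ψ) + bit b + bit (ψ c)) (flipAt-elsewhere ψ (≢-sym (<⇒≢ c<n))) ⟩
  ones n (flipAt c ψ) + bit (ψ n) + bit (ψ c)             ≡⟨ +-swapʳ (ones n (flipAt c ψ)) _ _ ⟩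
  ones n (flipAt c ψ) + bit (ψ c) + bit (ψ n)             ≡⟨ cong (_+ bit (ψ n)) (ones-flipAt n c ψ c<n) ⟩
  ones n ψ + bit (not (ψ c)) + bit (ψ n)                  ≡⟨ +-swapʳ (ones n ψ) _ _ ⟩
  ones n ψ + bit (ψ n) + bit (not (ψ c))                  ∎
  where open ≡-Reasoning

ones-transpose : ∀ n {c c'} ψ → c ≢ c' → c < n → c' < n → ψ c ≢ ψ c' → ones n (flipAt c (flipAt c' ψ)) ≡ ones n ψ
ones-transpose n {c} {c'} ψ c≢c' c<n c'<n ψc≢ψc' = +-cancelʳ-≡ _ _ _ (begin
  ones n (flipAt c ψ') + bit (ψ c)         ≡⟨ cong (λ b → ones n (flipAt c ψ') + bit b) (flipAt-elsewhere ψ c≢c') ⟨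
  ones n (flipAt c ψ') + bit (ψ' c)        ≡⟨ ones-flipAt n c ψ' c<n ⟩
  ones n ψ' + bit (not (ψ' c))             ≡⟨ cong (λ b → ones n ψ' + bit (not b)) (flipAt-elsewhere ψ c≢c') ⟩
  ones n ψ' + bit (not (ψ c))              ≡⟨ cong (λ b → ones n ψ' + bit b) other ⟩
  ones n ψ' + bit (ψ c')                   ≡⟨ ones-flipAt n c' ψ c'<n ⟩
  ones n ψ + bit (not (ψ c'))              ≡⟨ cong (λ b → ones n ψ + bit b) (sym other') ⟩
  ones n ψ + bit (ψ c)                     ∎)
  where
    open ≡-Reasoning
    ψ' = flipAt c' ψ
    other : not (ψ c) ≡ ψ c'
    other = trans (cong not (¬-not ψc≢ψc')) (not-involutive (ψ c'))
    other' : ψ c ≡ not (ψ c')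
    other' = ¬-not ψc≢ψc'

ones-complement : ∀ n ψ → ones n (not ∘ ψ) + ones n ψ ≡ n
ones-complement zero ψ = refl
ones-complement (suc n) ψ = begin
  ones n (not ∘ ψ) + bit (not (ψ n)) + (ones n ψ + bit (ψ n))
    ≡⟨ +-interchange (ones n (not ∘ ψ)) (bit (not (ψ n))) (ones n ψ) (bit (ψ n)) ⟩
  ones n (not ∘ ψ) + ones n ψ + (bit (not (ψ n)) + bit (ψ n))   ≡⟨ cong₂ _+_ (ones-complement n ψ) (bit-not+bit (ψ n)) ⟩
  n + 1                                                           ≡⟨ +-comm n 1 ⟩
  suc n                                                           ∎
  where open ≡-Reasoning

ones-positive : ∀ n ψ → 0 < ones n ψ → Σ ℕ λ x → x < n × ψ x ≡ true
ones-positive (suc n) ψ pos with ψ n in ψn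
... | true = n , ≤-refl , ψn
... | false with ones-positive n ψ (subst (0 <_) (+-identityʳ (ones n ψ)) pos)
...   | x , x<n , ψx = x , m<n⇒m<1+n x<n , ψx

ones-below : ∀ n ψ → ones n ψ < n → Σ ℕ λ x → x < n × ψ x ≡ false
ones-below n ψ below
  with ones-positive n (not ∘ ψ) (+-cancelʳ-< (ones n ψ) 0 _ (subst (ones n ψ <_) (sym (ones-complement n ψ)) below))
... | x , x<n , notψx = x , x<n , not-injective notψx

two-ones : ∀ n ψ → 2 ≤ ones n ψ → Σ ℕ λ p → Σ ℕ λ q → p < q × q < n × ψ p ≡ true × ψ q ≡ true
two-ones (suc n) ψ two with ψ n in ψn
... | true with ones-positive n ψ (+-cancelʳ-≤ 1 1 (ones n ψ) two)
...   | p , p<n , ψp = p , n , p<n , ≤-refl , ψp , ψn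
two-ones (suc n) ψ two | false with two-ones n ψ (subst (2 ≤_) (+-identityʳ (ones n ψ)) two)
...   | p , q , p<q , q<n , ψp , ψq = p , q , p<q , m<n⇒m<1+n q<n , ψp , ψq

two-zeros : ∀ n ψ → 2 + ones n ψ ≤ n → Σ ℕ λ p → Σ ℕ λ q → p < q × q < n × ψ p ≡ false × ψ q ≡ false
two-zeros n ψ room
  with two-ones n (not ∘ ψ) (+-cancelʳ-≤ (ones n ψ) 2 _ (subst (2 + ones n ψ ≤_) (sym (ones-complement n ψ)) room))
... | p , q , p<q , q<n , ψp , ψq =
  p , q , p<q , q<n , not-injective ψp , not-injective ψq

ones-odd-double : ∀ m → ones (m + m) odd ≡ m
ones-odd-double zero = refl
ones-odd-double (suc m) = begin
  ones (suc m + suc m) odd                                     ≡⟨ cong (λ x → ones (suc x) odd) (+-suc m m) ⟩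
  ones (m + m) odd + bit (odd (m + m)) + bit (odd (suc (m + m)))
    ≡⟨ cong₂ (λ a b → a + bit (not b) + bit (not (not b))) (ones-odd-double m) (isEven-double m) ⟩
  m + 0 + 1                                                    ≡⟨ cong (_+ 1) (+-identityʳ m) ⟩
  m + 1                                                        ≡⟨ +-comm m 1 ⟩
  suc m                                                        ∎
  where open ≡-Reasoning

ones≤ : ∀ n ψ → ones n ψ ≤ n
ones≤ n ψ = subst (ones n ψ ≤_) (ones-complement n ψ) (m≤n+m (ones n ψ) (ones n (not ∘ ψ)))

surplus : ∀ n ψ τ v → ones n ψ + bit (not v) ≡ ones n τ + bit v → Σ ℕ λ x → x < n × ψ x ≡ v
surplus n ψ τ true eq =
  ones-positive n ψ (subst (0 <_) (trans (+-comm 1 (ones n τ)) (sym (trans (sym (+-identityʳ (ones n ψ))) eq))) (s≤s z≤n))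
surplus n ψ τ false eq =
  ones-below n ψ (subst (_≤ n) (sym (trans (+-comm 1 (ones n ψ)) (trans eq (+-identityʳ (ones n τ))))) (ones≤ n τ))

flipAt-cancel : ∀ c ψ x → flipAt c (flipAt c ψ) x ≡ ψ x
flipAt-cancel c ψ x = xor-cancelʳ (ψ x) (x ≡ᵇ c)

flipAt-comm : ∀ a b ψ x → flipAt a (flipAt b ψ) x ≡ flipAt b (flipAt a ψ) x
flipAt-comm a b ψ x = xor-swapʳ (ψ x) (x ≡ᵇ b) (x ≡ᵇ a)

flipAt₂-elsewhere : ∀ {a b x} ψ → x ≢ a → x ≢ b → flipAt a (flipAt b ψ) x ≡ ψ x
flipAt₂-elsewhere ψ x≢a x≢b = trans (flipAt-elsewhere (flipAt _ ψ) x≢a) (flipAt-elsewhere ψ x≢b)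

-- The puzzle on a window of width g = 2h + 2

module Puzzle (h : ℕ) where

  last g : ℕ
  last = suc (h + h)
  g = suc last

  data Solvable : (ℕ → Bool) → Set where
    solved : ∀ {ψ} → (∀ x → x < last → ψ x ≡ odd x) → Solvable ψ
    swap   : ∀ {ψ} c → suc c < g → ψ c ≢ ψ (suc c) → Solvable (flipAt c (flipAt (suc c) ψ)) → Solvable ψ
    wrap   : ∀ {ψ} → ψ last ≡ ψ 0 → Solvable (flipAt 0 (flipAt last ψ)) → Solvable ψ
    agree  : ∀ {ψ ψ'} → (∀ x → x < g → ψ x ≡ ψ' x) → Solvable ψ' → Solvable ψ

  -- induction on q: transpose p with q - 1 and compose with the swap of q - 1 and q, before or after,
  -- whichever keeps the swapped values distinct
  transpose : ∀ {p q ψ} → p < q → q < g → ψ p ≢ ψ q → Solvable (flipAt p (flipAt q ψ)) → Solvable ψ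
  transpose {p} {suc q} {ψ} p<q q<g ψp≢ψq s with m≤n⇒m<n∨m≡n (s≤s⁻¹ p<q)
  ... | inj₂ refl = swap p q<g ψp≢ψq s
  ... | inj₁ p<q' with ψ q ≟ᵇ ψ p
  ...   | yes ψq≡ψp = swap q q<g (λ e → ψp≢ψq (trans (sym ψq≡ψp) e)) (transpose p<q' q'<g ψ₁p≢ψ₁q (agree same s))
    where
      q'<g = <-trans (n<1+n q) q<g
      ψ₁ = flipAt q (flipAt (suc q) ψ)
      ψ₁p≢ψ₁q : ψ₁ p ≢ ψ₁ q
      ψ₁p≢ψ₁q e = not-¬ refl (trans (sym ψ₁p) (trans e ψ₁q))
        where
          ψ₁p : ψ₁ p ≡ ψ p
          ψ₁p = flipAt₂-elsewhere ψ (<⇒≢ p<q') (<⇒≢ (<-trans p<q' (n<1+n q)))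
          ψ₁q : ψ₁ q ≡ not (ψ p)
          ψ₁q = trans (flipAt-here q (flipAt (suc q) ψ)) (cong not (trans (flipAt-elsewhere ψ (<⇒≢ (n<1+n q))) ψq≡ψp))
      same : ∀ x → x < g → flipAt p (flipAt q ψ₁) x ≡ flipAt p (flipAt (suc q) ψ) x
      same x _ = cong (_xor (x ≡ᵇ p)) (flipAt-cancel q (flipAt (suc q) ψ) x)
  ...   | no ψq≢ψp = transpose p<q' q'<g (≢-sym ψq≢ψp) (swap q q<g ψ₂q≢ψ₂q+1 (agree same s))
    where
      q'<g = <-trans (n<1+n q) q<g
      ψ₂ = flipAt p (flipAt q ψ)
      ψ₂q≢ψ₂q+1 : ψ₂ q ≢ ψ₂ (suc q)
      ψ₂q≢ψ₂q+1 e = not-¬ refl (trans (sym ψ₂q+1) (trans (sym e) ψ₂q))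
        where
          ψq≡ψq+1 : ψ q ≡ ψ (suc q)
          ψq≡ψq+1 = trans (¬-not ψq≢ψp) (trans (cong not (¬-not ψp≢ψq)) (not-involutive (ψ (suc q))))
          ψ₂q : ψ₂ q ≡ not (ψ (suc q))
          ψ₂q = trans (flipAt-elsewhere (flipAt q ψ) (≢-sym (<⇒≢ p<q'))) (trans (flipAt-here q ψ) (cong not ψq≡ψq+1))
          ψ₂q+1 : ψ₂ (suc q) ≡ ψ (suc q)
          ψ₂q+1 = flipAt₂-elsewhere ψ (≢-sym (<⇒≢ p<q)) (≢-sym (<⇒≢ (n<1+n q)))
      same : ∀ x → x < g → flipAt q (flipAt (suc q) ψ₂) x ≡ flipAt p (flipAt (suc q) ψ) x
      same x _ = begin
        flipAt q (flipAt (suc q) (flipAt p (flipAt q ψ))) x      ≡⟨ flipAt-comm q (suc q) ψ₂ x ⟩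
        flipAt (suc q) (flipAt q (flipAt p (flipAt q ψ))) x
          ≡⟨ cong (_xor (x ≡ᵇ suc q)) (flipAt-comm q p (flipAt q ψ) x) ⟩
        flipAt (suc q) (flipAt p (flipAt q (flipAt q ψ))) x
          ≡⟨ cong (λ b → (b xor (x ≡ᵇ p)) xor (x ≡ᵇ suc q)) (flipAt-cancel q ψ x) ⟩
        flipAt (suc q) (flipAt p ψ) x                            ≡⟨ flipAt-comm (suc q) p ψ x ⟩
        flipAt p (flipAt (suc q) ψ) x                            ∎
        where open ≡-Reasoning

  -- fix positions from the top down; at a mismatch at p, counting finds an earlier position holding the
  -- wanted value, which is transposed into place
  aligned : ∀ p {ψ τ} → p ≤ g → (∀ x → p ≤ x → x < g → ψ x ≡ τ x) → ones p ψ ≡ ones p τ →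
            Solvable τ → Solvable ψ
  aligned zero _ above _ s = agree (λ x → above x z≤n) s
  aligned (suc p) {ψ} {τ} p<g above eq s with ψ p ≟ᵇ τ p
  ... | yes ψp≡τp =
    aligned p (<⇒≤ p<g) above' (+-cancelʳ-≡ (bit (τ p)) _ _ (trans (cong (λ b → ones p ψ + bit b) (sym ψp≡τp)) eq)) s
    where
      above' : ∀ x → p ≤ x → x < g → ψ x ≡ τ x
      above' x p≤x x<g with m≤n⇒m<n∨m≡n p≤x
      ... | inj₁ p<x = above x p<x x<g
      ... | inj₂ refl = ψp≡τp
  ... | no ψp≢τp with surplus p ψ τ (τ p) (trans (cong (λ b → ones p ψ + bit b) (sym ψp≡¬τp)) eq)
    where ψp≡¬τp = ¬-not ψp≢τp
  ...   | q , q<p , ψq≡τp = transpose q<p p<g (λ e → ψp≢τp (trans (sym e) ψq≡τp)) (aligned p (<⇒≤ p<g) above' eq' s)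
    where
      ψp≡¬τp = ¬-not ψp≢τp
      χ = flipAt p ψ
      χq : χ q ≡ τ p
      χq = trans (flipAt-elsewhere ψ (<⇒≢ q<p)) ψq≡τp
      above' : ∀ x → p ≤ x → x < g → flipAt q χ x ≡ τ x
      above' x p≤x x<g with m≤n⇒m<n∨m≡n p≤x
      ... | inj₁ p<x = trans (flipAt₂-elsewhere ψ (≢-sym (<⇒≢ (<-trans q<p p<x))) (≢-sym (<⇒≢ p<x))) (above x p<x x<g)
      ... | inj₂ refl = trans (flipAt-elsewhere χ (≢-sym (<⇒≢ q<p)))
                              (trans (flipAt-here p ψ) (trans (cong not ψp≡¬τp) (not-involutive (τ p))))
      eq' : ones p (flipAt q χ) ≡ ones p τ
      eq' = +-cancelʳ-≡ (bit (τ p)) _ _ (begin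
        ones p (flipAt q χ) + bit (τ p)       ≡⟨ cong (λ b → ones p (flipAt q χ) + bit b) χq ⟨
        ones p (flipAt q χ) + bit (χ q)       ≡⟨ ones-flipAt p q χ q<p ⟩
        ones p χ + bit (not (χ q))            ≡⟨ cong₂ (λ m b → m + bit (not b)) (ones-flipAt-outside p ψ ≤-refl) χq ⟩
        ones p ψ + bit (not (τ p))            ≡⟨ cong (λ b → ones p ψ + bit b) ψp≡¬τp ⟨
        ones p ψ + bit (ψ p)                  ≡⟨ eq ⟩
        ones p τ + bit (τ p)                  ∎)
        where open ≡-Reasoning

  same-ones : ∀ {ψ τ} → ones g ψ ≡ ones g τ → Solvable τ → Solvable ψ
  same-ones = aligned g ≤-refl (λ x g≤x x<g → ⊥-elim (<-irrefl refl (<-≤-trans x<g g≤x)))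

  odd-last : odd last ≡ true
  odd-last = trans (not-involutive _) (isEven-double h)

  ones-odd : ones g odd ≡ suc h
  ones-odd = trans (cong (λ m → ones (suc m) odd) (sym (+-suc h h))) (ones-odd-double (suc h))

  ones-odd-but-last : ones g (flipAt last odd) ≡ h
  ones-odd-but-last = +-cancelʳ-≡ 1 _ _ (begin
    ones g (flipAt last odd) + 1                ≡⟨ cong (λ b → ones g (flipAt last odd) + bit b) odd-last ⟨
    ones g (flipAt last odd) + bit (odd last)   ≡⟨ ones-flipAt g last odd ≤-refl ⟩
    ones g odd + bit (not (odd last))           ≡⟨ cong₂ (λ m b → m + bit (not b)) ones-odd odd-last ⟩
    suc h + 0                                   ≡⟨ +-identityʳ (suc h) ⟩
    1 + h                                       ≡⟨ +-comm 1 h ⟩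
    h + 1                                       ∎)
    where open ≡-Reasoning

  balanced : ∀ {ψ} → ones g ψ ≡ h ⊎ ones g ψ ≡ suc h → Solvable ψ
  balanced (inj₁ eq) = same-ones (trans eq (sym ones-odd-but-last)) (solved λ x x<last → flipAt-elsewhere odd (<⇒≢ x<last))
  balanced (inj₂ eq) = same-ones (trans eq (sym ones-odd)) (solved λ _ _ → refl)

  private
    0<last : 0 < last
    0<last = s≤s z≤n

    0<g : 0 < g
    0<g = s≤s z≤n

  ends-with : ∀ {ψ p q v} → p < q → q < g → ψ p ≡ v → ψ q ≡ v →
              Σ (ℕ → Bool) λ ψ' → ψ' 0 ≡ v × ψ' last ≡ v × ones g ψ' ≡ ones g ψ
  ends-with {ψ} {p} {q} {v} p<q q<g ψp ψq = back front
    where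
      0<q = <-≤-trans (s≤s z≤n) p<q
      front : Σ (ℕ → Bool) λ ψ₁ → ψ₁ 0 ≡ v × ψ₁ q ≡ v × ones g ψ₁ ≡ ones g ψ
      front with ψ 0 ≟ᵇ v
      ... | yes ψ0 = ψ , ψ0 , ψq , refl
      ... | no ψ0≢v = flipAt 0 (flipAt p ψ) , at-0 , at-q ,
                      ones-transpose g ψ (≢-sym p≢0) 0<g (<-trans p<q q<g) (λ e → ψ0≢v (trans e ψp))
        where
          p≢0 : p ≢ 0
          p≢0 refl = ψ0≢v ψp
          at-0 = trans (flipAt-here 0 (flipAt p ψ))
                   (trans (cong not (trans (flipAt-elsewhere ψ (≢-sym p≢0)) (¬-not ψ0≢v))) (not-involutive v))
          at-q = trans (flipAt₂-elsewhere ψ (≢-sym (<⇒≢ 0<q)) (≢-sym (<⇒≢ p<q))) ψq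
      back : _ → Σ (ℕ → Bool) λ ψ' → ψ' 0 ≡ v × ψ' last ≡ v × ones g ψ' ≡ ones g ψ
      back (ψ₁ , ψ₁0 , ψ₁q , count₁) with ψ₁ last ≟ᵇ v
      ... | yes ψ₁last = ψ₁ , ψ₁0 , ψ₁last , count₁
      ... | no ψ₁last≢v = flipAt q (flipAt last ψ₁) , at-0 , at-last ,
                          trans (ones-transpose g ψ₁ q≢last q<g ≤-refl (λ e → ψ₁last≢v (trans (sym e) ψ₁q))) count₁
        where
          q≢last : q ≢ last
          q≢last refl = ψ₁last≢v ψ₁q
          at-0 = trans (flipAt₂-elsewhere ψ₁ (<⇒≢ 0<q) (<⇒≢ 0<last)) ψ₁0
          at-last = trans (flipAt-elsewhere (flipAt last ψ₁) (≢-sym q≢last))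
                      (trans (flipAt-here last ψ₁) (trans (cong not (¬-not ψ₁last≢v)) (not-involutive v)))

  wrap-step : ∀ {ψ p q} v → p < q → q < g → ψ p ≡ v → ψ q ≡ v →
              (∀ {ψ'} → ones g ψ' + bit v + bit v ≡ ones g ψ + bit (not v) + bit (not v) → Solvable ψ') → Solvable ψ
  wrap-step {ψ} v p<q q<g ψp ψq next with ends-with p<q q<g ψp ψq
  ... | ψ' , ψ'0 , ψ'last , same = same-ones (sym same) (wrap (trans ψ'last (sym ψ'0)) (next count))
    where
      χ = flipAt last ψ'
      χ0 : χ 0 ≡ v
      χ0 = trans (flipAt-elsewhere ψ' (<⇒≢ 0<last)) ψ'0
      count : ones g (flipAt 0 χ) + bit v + bit v ≡ ones g ψ + bit (not v) + bit (not v)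
      count = begin
        ones g (flipAt 0 χ) + bit v + bit v                 ≡⟨ cong (λ b → ones g (flipAt 0 χ) + bit b + bit v) χ0 ⟨
        ones g (flipAt 0 χ) + bit (χ 0) + bit v             ≡⟨ cong (_+ bit v) (ones-flipAt g 0 χ 0<g) ⟩
        ones g χ + bit (not (χ 0)) + bit v
          ≡⟨ cong₂ (λ a b → ones g χ + bit (not a) + bit b) χ0 (sym ψ'last) ⟩
        ones g χ + bit (not v) + bit (ψ' last)              ≡⟨ +-swapʳ (ones g χ) _ _ ⟩
        ones g χ + bit (ψ' last) + bit (not v)              ≡⟨ cong (_+ bit (not v)) (ones-flipAt g last ψ' ≤-refl) ⟩
        ones g ψ' + bit (not (ψ' last)) + bit (not v)       ≡⟨ cong₂ (λ m b → m + bit (not b) + bit (not v)) same ψ'last ⟩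
        ones g ψ + bit (not v) + bit (not v)                ∎
        where open ≡-Reasoning

  private
    plus-two : ∀ a → a + bit true + bit true ≡ suc (suc a)
    plus-two a = trans (+-assoc a 1 1) (+-comm a 2)

    plus-none : ∀ a → a + bit false + bit false ≡ a
    plus-none a = trans (+-identityʳ (a + 0)) (+-identityʳ a)

    +-suc-suc : ∀ a d → a + suc (suc d) ≡ suc (suc (a + d))
    +-suc-suc a d = trans (+-suc a (suc d)) (cong suc (+-suc a d))

  solvable-above : ∀ d {ψ} → ones g ψ ≡ h + d → Solvable ψ
  solvable-above zero eq = balanced (inj₁ (trans eq (+-identityʳ h)))
  solvable-above (suc zero) eq = balanced (inj₂ (trans eq (+-comm h 1)))
  solvable-above (suc (suc d)) {ψ} eq
    with two-ones g ψ (subst (2 ≤_) (sym eq) (≤-trans (s≤s (s≤s z≤n)) (m≤n+m (suc (suc d)) h)))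
  ... | p , q , p<q , q<g , ψp , ψq = wrap-step true p<q q<g ψp ψq λ {ψ'} count →
    solvable-above d (suc-injective (suc-injective (begin
      suc (suc (ones g ψ'))        ≡⟨ plus-two (ones g ψ') ⟨
      ones g ψ' + 1 + 1            ≡⟨ count ⟩
      ones g ψ + 0 + 0             ≡⟨ plus-none (ones g ψ) ⟩
      ones g ψ                     ≡⟨ eq ⟩
      h + suc (suc d)              ≡⟨ +-suc-suc h d ⟩
      suc (suc (h + d))            ∎)))
    where open ≡-Reasoning

  solvable-below : ∀ d {ψ} → ones g ψ + d ≡ h → Solvable ψ
  solvable-below zero eq = balanced (inj₁ (trans (sym (+-identityʳ _)) eq))
  solvable-below (suc d) {ψ} eq with two-zeros g ψ room
    where
      room : 2 + ones g ψ ≤ g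
      room = s≤s (s≤s (≤-trans (subst (ones g ψ ≤_) eq (m≤m+n (ones g ψ) (suc d))) (m≤n+m h h)))
  ... | p , q , p<q , q<g , ψp , ψq = wrap-step false p<q q<g ψp ψq λ {ψ'} count →
    raised d eq (trans (sym (plus-none (ones g ψ'))) (trans count (plus-two (ones g ψ))))
    where
      raised : ∀ d {ψ'} → ones g ψ + suc d ≡ h → ones g ψ' ≡ suc (suc (ones g ψ)) → Solvable ψ'
      raised zero eq count' = balanced (inj₂ (trans count' (cong suc (trans (+-comm 1 (ones g ψ)) eq))))
      raised (suc d) {ψ'} eq count' = solvable-below d (trans (cong (_+ d) count') (trans (sym (+-suc-suc (ones g ψ) d)) eq))

  solvable : ∀ ψ → Solvable ψ
  solvable ψ with ≤-total (ones g ψ) h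
  ... | inj₁ below = let d , eq = m≤n⇒∃[o]m+o≡n below in solvable-below d eq
  ... | inj₂ above = let d , eq = m≤n⇒∃[o]m+o≡n above in solvable-above d (sym eq)

-- Faces, alternating boundaries and flip reachability

≟-refl : ∀ {n} (i : Fin n) → ⌊ i FinP.≟ i ⌋ ≡ true
≟-refl i with i FinP.≟ i
... | yes _ = refl
... | no i≢i = ⊥-elim (i≢i refl)

edgeEq-refl : ∀ {N K} (e : Edge N K) → edgeEq e e ≡ true
edgeEq-refl (hor i j) rewrite ≟-refl i | ≟-refl j = refl
edgeEq-refl (ver i j) rewrite ≟-refl i | ≟-refl j = refl

edgeEq-sound : ∀ {N K} (e e' : Edge N K) → edgeEq e e' ≡ true → e ≡ e'
edgeEq-sound (hor i j) (hor i' j') p with i FinP.≟ i' | j FinP.≟ j'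
... | yes refl | yes refl = refl
edgeEq-sound (ver i j) (ver i' j') p with i FinP.≟ i' | j FinP.≟ j'
... | yes refl | yes refl = refl

hor-injective : ∀ {N K} {i i' : Fin N} {j j' : Fin K} → hor i j ≡ hor i' j' → (i , j) ≡ (i' , j')
hor-injective refl = refl

ver-injective : ∀ {N K} {i i' : Fin N} {j j' : Fin K} → ver i j ≡ ver i' j' → (i , j) ≡ (i' , j')
ver-injective refl = refl

hor≢ver : ∀ {N K} {i i' : Fin N} {j j' : Fin K} → hor i j ≢ ver i' j'
hor≢ver ()

module _ {N K : ℕ} (R : ℕ) (f : Face N K) where

  private
    e₁ = faceE₁ R f
    e₂ = faceE₂ R f
    e₃ = faceE₃ R f
    e₄ = faceE₄ R f

  inFace-faceE₁ : inFace R f e₁ ≡ true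
  inFace-faceE₁ = ∨-introˡ (edgeEq e₁ e₂ ∨ edgeEq e₁ e₃ ∨ edgeEq e₁ e₄) (edgeEq-refl e₁)

  inFace-faceE₂ : inFace R f e₂ ≡ true
  inFace-faceE₂ = ∨-introʳ (edgeEq e₂ e₁) (∨-introˡ (edgeEq e₂ e₃ ∨ edgeEq e₂ e₄) (edgeEq-refl e₂))

  inFace-faceE₃ : inFace R f e₃ ≡ true
  inFace-faceE₃ = ∨-introʳ (edgeEq e₃ e₁) (∨-introʳ (edgeEq e₃ e₂) (∨-introˡ (edgeEq e₃ e₄) (edgeEq-refl e₃)))

  inFace-faceE₄ : inFace R f e₄ ≡ true
  inFace-faceE₄ = ∨-introʳ (edgeEq e₄ e₁) (∨-introʳ (edgeEq e₄ e₂) (∨-introʳ (edgeEq e₄ e₃) (edgeEq-refl e₄)))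

  inFace⇒boundary : ∀ e → inFace R f e ≡ true →
    e ≡ faceE₁ R f ⊎ e ≡ faceE₂ R f ⊎ e ≡ faceE₃ R f ⊎ e ≡ faceE₄ R f
  inFace⇒boundary e p with ∨-true p
  ... | inj₁ p₁ = inj₁ (edgeEq-sound _ _ p₁)
  ... | inj₂ p₂ with ∨-true p₂
  ...   | inj₁ q₂ = inj₂ (inj₁ (edgeEq-sound _ _ q₂))
  ...   | inj₂ p₃ with ∨-true p₃
  ...     | inj₁ q₃ = inj₂ (inj₂ (inj₁ (edgeEq-sound _ _ q₃)))
  ...     | inj₂ q₄ = inj₂ (inj₂ (inj₂ (edgeEq-sound _ _ q₄)))

  Alternating-cong : ∀ {M M' : EdgeSet N K} → (∀ e → inFace R f e ≡ true → M e ≡ M' e) →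
                     Alternating R M f → Alternating R M' f
  Alternating-cong {M} {M'} agree = Sum.map boundary boundary
    where
      moved : ∀ e {b} → inFace R f e ≡ true → M e ≡ b → M' e ≡ b
      moved e p = trans (sym (agree e p))
      boundary : ∀ {b₁ b₂ b₃ b₄} → M e₁ ≡ b₁ × M e₂ ≡ b₂ × M e₃ ≡ b₃ × M e₄ ≡ b₄ →
                 M' e₁ ≡ b₁ × M' e₂ ≡ b₂ × M' e₃ ≡ b₃ × M' e₄ ≡ b₄
      boundary (a , b , c , d) =
        moved e₁ inFace-faceE₁ a , moved e₂ inFace-faceE₂ b , moved e₃ inFace-faceE₃ c , moved e₄ inFace-faceE₄ d

module _ {N K : ℕ} (R : ℕ) where

  Reaches : EdgeSet N K → EdgeSet N K → Set
  Reaches M M' = Σ (EdgeSet N K) λ M'' → FlipReachable R M M'' × M'' ≗ₑ M'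

  flip-respˡ : ∀ {M₀ M X : EdgeSet N K} → M₀ ≗ₑ M → Flip R M X → Flip R M₀ X
  flip-respˡ M₀≗M (f , alt , X≡) =
    f , Alternating-cong R f (λ e _ → sym (M₀≗M e)) alt , λ e → trans (X≡ e) (cong (_xor inFace R f e) (sym (M₀≗M e)))

  flip-sym : ∀ {M X : EdgeSet N K} → Flip R M X → Flip R X M
  flip-sym {M} {X} (f , alt , X≡) =
    f , Sum.swap (Sum.map negated negated alt) , λ e → sym (trans (cong (_xor inFace R f e) (X≡ e)) (xor-cancelʳ (M e) _))
    where
      on-face : ∀ e {b} → inFace R f e ≡ true → M e ≡ b → X e ≡ not b
      on-face e p Me≡b = trans (X≡ e) (trans (cong₂ _xor_ Me≡b p) (xor-true _))
      negated : ∀ {b₁ b₂ b₃ b₄} →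
                M (faceE₁ R f) ≡ b₁ × M (faceE₂ R f) ≡ b₂ × M (faceE₃ R f) ≡ b₃ × M (faceE₄ R f) ≡ b₄ →
                X (faceE₁ R f) ≡ not b₁ × X (faceE₂ R f) ≡ not b₂ ×
                X (faceE₃ R f) ≡ not b₃ × X (faceE₄ R f) ≡ not b₄
      negated (a , b , c , d) =
        on-face _ (inFace-faceE₁ R f) a , on-face _ (inFace-faceE₂ R f) b ,
        on-face _ (inFace-faceE₃ R f) c , on-face _ (inFace-faceE₄ R f) d

  ≗ₑ⇒reaches : ∀ {M M'} → M ≗ₑ M' → Reaches M M'
  ≗ₑ⇒reaches {M} M≗M' = M , ε , M≗M'

  reaches-refl : ∀ {M} → Reaches M M
  reaches-refl = ≗ₑ⇒reaches λ _ → refl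

  reaches-respˡ : ∀ {M₀ M M'} → M₀ ≗ₑ M → Reaches M M' → Reaches M₀ M'
  reaches-respˡ M₀≗M (M'' , ε , M''≗M') = _ , ε , λ e → trans (M₀≗M e) (M''≗M' e)
  reaches-respˡ M₀≗M (M'' , step ◅ steps , M''≗M') = M'' , flip-respˡ M₀≗M step ◅ steps , M''≗M'

  reaches-trans : ∀ {M₁ M₂ M₃} → Reaches M₁ M₂ → Reaches M₂ M₃ → Reaches M₁ M₃
  reaches-trans (_ , steps , ≗M₂) r with reaches-respˡ ≗M₂ r
  ... | M'' , steps' , ≗M₃ = M'' , steps ◅◅ steps' , ≗M₃

  reaches-sym : ∀ {M M'} → Reaches M M' → Reaches M' M
  reaches-sym {M} (_ , steps , ≗M') = reaches-respˡ (λ e → sym (≗M' e)) (M , reverse flip-sym steps , λ _ → refl)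

  flip-reaches : ∀ {M X M'} → Flip R M X → Reaches X M' → Reaches M M'
  flip-reaches step (M'' , steps , ≗M') = M'' , step ◅ steps , ≗M'

  faceUnion : List (Face N K) → EdgeSet N K
  faceUnion fs e = any (λ f → inFace R f e) fs

  faceUnion⁻ : ∀ fs e → faceUnion fs e ≡ true → Σ (Face N K) λ f → f ∈ fs × inFace R f e ≡ true
  faceUnion⁻ fs e p with find (any⁻ _ fs (Equivalence.from T-≡ p))
  ... | f , f∈fs , inf = f , f∈fs , Equivalence.to T-≡ inf

  faceUnion⁺ : ∀ {fs f} e → f ∈ fs → inFace R f e ≡ true → faceUnion fs e ≡ true
  faceUnion⁺ e f∈fs p = Equivalence.to T-≡ (any⁺ _ (lose f∈fs (Equivalence.from T-≡ p)))

  EdgeDisjoint : List (Face N K) → Set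
  EdgeDisjoint fs = ∀ {f f'} e → f ∈ fs → f' ∈ fs → inFace R f e ≡ true → inFace R f' e ≡ true → f ≡ f'

  flipAll : ∀ M fs → Unique fs → All (Alternating R M) fs → EdgeDisjoint fs →
            Reaches M (λ e → M e xor faceUnion fs e)
  flipAll M [] _ _ _ = ≗ₑ⇒reaches λ e → sym (xor-identityʳ (M e))
  flipAll M (f ∷ fs) (f∉fs ∷ unique) (alt ∷ alts) disjoint =
    flip-reaches (f , alt , λ _ → refl)
      (reaches-trans (flipAll M' fs unique alts' (λ e m m' → disjoint e (there m) (there m'))) (≗ₑ⇒reaches merge))
    where
      M' : EdgeSet N K
      M' e = M e xor inFace R f e
      not-both : ∀ e → inFace R f e ≡ true → faceUnion fs e ≡ true → ⊥
      not-both e p q with faceUnion⁻ fs e q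
      ... | f' , f'∈fs , p' = All.lookup f∉fs f'∈fs (disjoint e (here refl) (there f'∈fs) p p')
      alts' : All (Alternating R M') fs
      alts' = All.tabulate λ f'∈fs → Alternating-cong R _
                (λ e p → sym (trans (cong (M e xor_) (¬-not λ q → not-both e q (faceUnion⁺ e f'∈fs p))) (xor-identityʳ (M e))))
                (All.lookup alts f'∈fs)
      merge : ∀ e → M' e xor faceUnion fs e ≡ M e xor (inFace R f e ∨ faceUnion fs e)
      merge e = xor-∨-disjoint (M e) (inFace R f e) (faceUnion fs e) (not-both e)

%-absorbˡ : ∀ m n d .{{_ : NonZero d}} → (m % d + n) % d ≡ (m + n) % d
%-absorbˡ m n d = begin
  (m % d + n) % d          ≡⟨ %-distribˡ-+ (m % d) n d ⟩
  (m % d % d + n % d) % d  ≡⟨ cong (λ x → (x + n % d) % d) (m%n%n≡m%n m d) ⟩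
  (m % d + n % d) % d      ≡⟨ %-distribˡ-+ m n d ⟨
  (m + n) % d              ∎
  where open ≡-Reasoning

module _ {k : ℕ} where

  toℕ-addMod : ∀ (j : Fin (suc k)) r → toℕ (addMod j r) ≡ (toℕ j + r) % suc k
  toℕ-addMod j r = FinP.toℕ-fromℕ< (m%n<n (toℕ j + r) (suc k))

  addMod-addMod : ∀ (j : Fin (suc k)) r s → addMod (addMod j r) s ≡ addMod j (r + s)
  addMod-addMod j r s = FinP.toℕ-injective (begin
    toℕ (addMod (addMod j r) s)      ≡⟨ toℕ-addMod (addMod j r) s ⟩
    (toℕ (addMod j r) + s) % suc k   ≡⟨ cong (λ x → (x + s) % suc k) (toℕ-addMod j r) ⟩
    ((toℕ j + r) % suc k + s) % suc k ≡⟨ %-absorbˡ (toℕ j + r) s (suc k) ⟩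
    (toℕ j + r + s) % suc k          ≡⟨ cong (_% suc k) (+-assoc (toℕ j) r s) ⟩
    (toℕ j + (r + s)) % suc k        ≡⟨ toℕ-addMod j (r + s) ⟨
    toℕ (addMod j (r + s))           ∎)
    where open ≡-Reasoning

  addMod-multiple : ∀ (j : Fin (suc k)) q → addMod j (q * suc k) ≡ j
  addMod-multiple j q = FinP.toℕ-injective (begin
    toℕ (addMod j (q * suc k))        ≡⟨ toℕ-addMod j (q * suc k) ⟩
    (toℕ j + q * suc k) % suc k       ≡⟨ [m+kn]%n≡m%n (toℕ j) q (suc k) ⟩
    toℕ j % suc k                     ≡⟨ m<n⇒m%n≡m (FinP.toℕ<n j) ⟩
    toℕ j                             ∎)
    where open ≡-Reasoning

  addMod-inverse : ∀ (j : Fin (suc k)) r → addMod (addMod j r) (r * k) ≡ j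
  addMod-inverse j r = trans (addMod-addMod j r (r * k)) (trans (cong (addMod j) (sym (*-suc r k))) (addMod-multiple j r))

  addMod-injective : ∀ (j j' : Fin (suc k)) r → addMod j r ≡ addMod j' r → j ≡ j'
  addMod-injective j j' r eq =
    trans (sym (addMod-inverse j r)) (trans (cong (λ x → addMod x (r * k)) eq) (addMod-inverse j' r))

  addMod-surjective : ∀ (j : Fin (suc k)) r → Σ (Fin (suc k)) λ j' → addMod j' r ≡ j
  addMod-surjective j r = addMod j (r * k) , trans (addMod-addMod j (r * k) r)
    (trans (cong (addMod j) (trans (+-comm (r * k) r) (sym (*-suc r k)))) (addMod-multiple j r))

data VEndView {n K : ℕ} (R : ℕ) (i : Fin (suc n)) (j : Fin K) : Vertex (suc n) K → Set where
  inner : (p : suc (toℕ i) < suc n) → VEndView R i j (fromℕ< p , j)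
  wrap  : toℕ i ≡ n → VEndView R i j (zero , addMod j R)

vEnd-view : ∀ {n K} R (i : Fin (suc n)) (j : Fin K) → VEndView R i j (vEnd R i j)
vEnd-view {n} R i j with suc (toℕ i) <? suc n
... | yes p = inner p
... | no ¬p = wrap (≤∧≮⇒≡ (s≤s⁻¹ (FinP.toℕ<n i)) (λ q → ¬p (s≤s q)))

fromℕ<-suc≢zero : ∀ {m N} (p : suc m < suc N) → fromℕ< p ≢ zero
fromℕ<-suc≢zero p eq with trans (sym (FinP.toℕ-fromℕ< p)) (cong toℕ eq)
... | ()

module _ {n k : ℕ} (R : ℕ) where

  vEnd-injective : ∀ {i i' : Fin (suc n)} {j j' : Fin (suc k)} → vEnd R i j ≡ vEnd R i' j' → (i , j) ≡ (i' , j')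
  vEnd-injective {i} {i'} {j} {j'} eq with vEnd R i j | vEnd-view R i j | vEnd R i' j' | vEnd-view R i' j'
  ... | _ | inner p | _ | inner p' = cong₂ _,_ (FinP.toℕ-injective (suc-injective (begin
          suc (toℕ i)               ≡⟨ FinP.toℕ-fromℕ< p ⟨
          toℕ (fromℕ< p)           ≡⟨ cong (toℕ ∘ proj₁) eq ⟩
          toℕ (fromℕ< p')          ≡⟨ FinP.toℕ-fromℕ< p' ⟩
          suc (toℕ i')              ∎))) (cong proj₂ eq)
    where open ≡-Reasoning
  ... | _ | inner p | _ | wrap _  = ⊥-elim (fromℕ<-suc≢zero p (cong proj₁ eq))
  ... | _ | wrap _  | _ | inner p' = ⊥-elim (fromℕ<-suc≢zero p' (cong proj₁ (sym eq)))
  ... | _ | wrap w  | _ | wrap w' =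
    cong₂ _,_ (FinP.toℕ-injective (trans w (sym w'))) (addMod-injective j j' R (cong proj₂ eq))

  vEnd-fromℕ : ∀ (j : Fin (suc k)) → vEnd R (fromℕ n) j ≡ (zero , addMod j R)
  vEnd-fromℕ j with vEnd R (fromℕ n) j | vEnd-view R (fromℕ n) j
  ... | _ | inner p = ⊥-elim (<-irrefl refl (subst (λ x → suc x < suc n) (FinP.toℕ-fromℕ n) p))
  ... | _ | wrap _  = refl

  vEnd-inject₁ : ∀ (i : Fin n) (j : Fin (suc k)) → vEnd R (inject₁ i) j ≡ (suc i , j)
  vEnd-inject₁ i j with vEnd R (inject₁ i) j | vEnd-view R (inject₁ i) j
  ... | _ | inner p = cong (_, j) (FinP.toℕ-injective (trans (FinP.toℕ-fromℕ< p) (cong suc (FinP.toℕ-inject₁ i))))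
  ... | _ | wrap w  = ⊥-elim (<-irrefl (trans (sym (FinP.toℕ-inject₁ i)) w) (FinP.toℕ<n i))

  vEnd-surjective : ∀ (i : Fin (suc n)) (j : Fin (suc k)) →
                    Σ (Fin (suc n) × Fin (suc k)) λ f → vEnd R (proj₁ f) (proj₂ f) ≡ (i , j)
  vEnd-surjective zero j with addMod-surjective j R
  ... | j' , j'+R≡j = (fromℕ n , j') , trans (vEnd-fromℕ j') (cong (zero ,_) j'+R≡j)
  vEnd-surjective (suc i) j = (inject₁ i , j) , vEnd-inject₁ i j

-- Vertical matchings and rungs on the torus

module Torus (n k R : ℕ) (n-even : isEven n ≡ true) where

  N K : ℕ
  N = suc n
  K = suc k

  record Twisted (T : ℕ → Bool) : Set where
    field
      periodic     : Periodic K T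
      antiperiodic : Antiperiodic R T

  vertical : (ℕ → Bool) → EdgeSet N K
  vertical T (hor i j) = false
  vertical T (ver i j) = isEven (toℕ i) xor T (toℕ j)

  -- X marks the columns j whose horizontal edges v_{i,j} v_{i,j+1} are all taken;
  -- column j + k is column j - 1
  withRungs : (X T : ℕ → Bool) → EdgeSet N K
  withRungs X T (hor i j) = X (toℕ j)
  withRungs X T (ver i j) = vertical T (ver i j) ∧ not (X (toℕ j) ∨ X (toℕ j + k))

  record Admissible (T X : ℕ → Bool) : Set where
    field
      periodic   : Periodic K X
      R-periodic : Periodic R X
      sparse     : ∀ x → X x ≡ true → X (suc x) ≡ false
      T-steady   : ∀ x → X x ≡ true → T x ≡ T (suc x)

  module _ {F : ℕ → Bool} (per : Periodic K F) where

    periodic-addMod : ∀ (j : Fin K) r → F (toℕ (addMod j r)) ≡ F (toℕ j + r)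
    periodic-addMod j r = trans (cong F (toℕ-addMod j r)) (periodic-mod per (toℕ j + r))

    periodic-suc : ∀ (j : Fin K) → F (toℕ (addMod j 1)) ≡ F (suc (toℕ j))
    periodic-suc j = trans (periodic-addMod j 1) (cong F (+-comm (toℕ j) 1))

    periodic-pred : ∀ (j : Fin K) → F (toℕ (addMod j 1) + k) ≡ F (toℕ j)
    periodic-pred j = begin
      F (toℕ (addMod j 1) + k)           ≡⟨ periodic-mod per _ ⟨
      F ((toℕ (addMod j 1) + k) % K)     ≡⟨ cong (λ x → F ((x + k) % K)) (toℕ-addMod j 1) ⟩
      F (((toℕ j + 1) % K + k) % K)      ≡⟨ cong F (%-absorbˡ (toℕ j + 1) k K) ⟩
      F ((toℕ j + 1 + k) % K)            ≡⟨ cong (λ x → F (x % K)) (+-assoc (toℕ j) 1 k) ⟩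
      F ((toℕ j + K) % K)                ≡⟨ periodic-mod per _ ⟩
      F (toℕ j + K)                      ≡⟨ per (toℕ j) ⟩
      F (toℕ j)                          ∎
      where open ≡-Reasoning

  module _ {T : ℕ → Bool} (tw : Twisted T) where
    open Twisted tw

    vertical-alternates : ∀ {i' j' i j} → vEnd R i' j' ≡ (i , j) →
                          vertical T (ver i j) ≡ not (vertical T (ver i' j'))
    vertical-alternates {i'} {j'} eq with vEnd R i' j' | vEnd-view R i' j'
    vertical-alternates {i'} {j'} refl | _ | inner p =
      trans (cong (λ x → isEven x xor T (toℕ j')) (FinP.toℕ-fromℕ< p))
            (sym (not-distribˡ-xor (isEven (toℕ i')) (T (toℕ j'))))
    vertical-alternates {i'} {j'} refl | _ | wrap w =
      cong not (trans (periodic-addMod periodic j' R)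
               (trans (antiperiodic (toℕ j')) (cong (_xor T (toℕ j')) (sym (trans (cong isEven w) n-even)))))

  module _ {F : ℕ → Bool} (per : Periodic K F) (R-per : Periodic R F) where

    periodic-along : ∀ {i' i : Fin N} {j' j : Fin K} → vEnd R i' j' ≡ (i , j) → F (toℕ j) ≡ F (toℕ j')
    periodic-along {i' = i'} {j' = j'} eq with vEnd R i' j' | vEnd-view R i' j'
    periodic-along {i' = i'} {j' = j'} refl | _ | inner p = refl
    periodic-along {i' = i'} {j' = j'} refl | _ | wrap w = trans (periodic-addMod per j' R) (R-per (toℕ j'))

  module Rungs {T X : ℕ → Bool} (tw : Twisted T) (adm : Admissible T X) where
    open Admissible adm

    vertical-steady : ∀ i j → X (toℕ j) ≡ true → vertical T (ver i (addMod j 1)) ≡ vertical T (ver i j)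
    vertical-steady i j x =
      cong (isEven (toℕ i) xor_) (trans (periodic-suc (Twisted.periodic tw) j) (sym (T-steady (toℕ j) x)))

    selected : Face N K → Bool
    selected (i , j) = X (toℕ j) ∧ vertical T (ver i j)

    allFaces : List (Face N K)
    allFaces = cartesianProduct (allFin N) (allFin K)

    rungFaces : List (Face N K)
    rungFaces = filterᵇ selected allFaces

    ∈rungFaces⁺ : ∀ f → selected f ≡ true → f ∈ rungFaces
    ∈rungFaces⁺ (i , j) s =
      ∈-filter⁺ (T? ∘ selected) (∈-cartesianProduct⁺ (∈-allFin i) (∈-allFin j)) (Equivalence.from T-≡ s)

    ∈rungFaces⁻ : ∀ f → f ∈ rungFaces → selected f ≡ true
    ∈rungFaces⁻ f m = Equivalence.to T-≡ (proj₂ (∈-filter⁻ (T? ∘ selected) m))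

    selected-split : ∀ i j → selected (i , j) ≡ true → X (toℕ j) ≡ true × vertical T (ver i j) ≡ true
    selected-split i j = ∧-true {X (toℕ j)} {vertical T (ver i j)}

    alternating : ∀ f → selected f ≡ true → Alternating R (vertical T) f
    alternating (i , j) s with selected-split i j s
    ... | x , v = inj₂ (refl , trans (vertical-steady i j x) v , refl , v)

    faceE₁≢faceE₃ : ∀ {f f'} → selected f ≡ true → selected f' ≡ true → faceE₁ R f ≢ faceE₃ R f'
    faceE₁≢faceE₃ {i , j} {i' , j'} s s' eq with selected-split i j s | selected-split i' j' s'
    ... | _ , v | _ , v' = true≢false (trans (sym v) (trans (vertical-alternates tw (sym (hor-injective eq))) (cong not v')))

    faceE₂≢faceE₄ : ∀ {f f'} → selected f ≡ true → selected f' ≡ true → faceE₂ R f ≢ faceE₄ R f'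
    faceE₂≢faceE₄ {i , j} {i' , j'} s s' eq with selected-split i j s | selected-split i' j' s'
    ... | x , _ | x' , _ = true≢false (trans (sym x') (trans (cong (X ∘ toℕ ∘ proj₂) (sym (ver-injective eq)))
                              (trans (periodic-suc periodic j) (sparse (toℕ j) x))))

    disjoint : EdgeDisjoint R rungFaces
    disjoint {f} {f'} e m m' p p' = same (inFace⇒boundary R f e p) (inFace⇒boundary R f' e p')
      where
        s = ∈rungFaces⁻ f m
        s' = ∈rungFaces⁻ f' m'
        same : _ → _ → f ≡ f'
        same (inj₁ a) (inj₁ b) = hor-injective (trans (sym a) b)
        same (inj₁ a) (inj₂ (inj₁ b)) = ⊥-elim (hor≢ver (trans (sym a) b))
        same (inj₁ a) (inj₂ (inj₂ (inj₁ b))) = ⊥-elim (faceE₁≢faceE₃ s s' (trans (sym a) b))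
        same (inj₁ a) (inj₂ (inj₂ (inj₂ b))) = ⊥-elim (hor≢ver (trans (sym a) b))
        same (inj₂ (inj₁ a)) (inj₁ b) = ⊥-elim (hor≢ver (trans (sym b) a))
        same (inj₂ (inj₁ a)) (inj₂ (inj₁ b)) with ver-injective (trans (sym a) b)
        ... | eq = cong₂ _,_ (cong proj₁ eq) (addMod-injective _ _ 1 (cong proj₂ eq))
        same (inj₂ (inj₁ a)) (inj₂ (inj₂ (inj₁ b))) = ⊥-elim (hor≢ver (trans (sym b) a))
        same (inj₂ (inj₁ a)) (inj₂ (inj₂ (inj₂ b))) = ⊥-elim (faceE₂≢faceE₄ s s' (trans (sym a) b))
        same (inj₂ (inj₂ (inj₁ a))) (inj₁ b) = ⊥-elim (faceE₁≢faceE₃ s' s (trans (sym b) a))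
        same (inj₂ (inj₂ (inj₁ a))) (inj₂ (inj₁ b)) = ⊥-elim (hor≢ver (trans (sym a) b))
        same (inj₂ (inj₂ (inj₁ a))) (inj₂ (inj₂ (inj₁ b))) = vEnd-injective R (hor-injective (trans (sym a) b))
        same (inj₂ (inj₂ (inj₁ a))) (inj₂ (inj₂ (inj₂ b))) = ⊥-elim (hor≢ver (trans (sym a) b))
        same (inj₂ (inj₂ (inj₂ a))) (inj₁ b) = ⊥-elim (hor≢ver (trans (sym b) a))
        same (inj₂ (inj₂ (inj₂ a))) (inj₂ (inj₁ b)) = ⊥-elim (faceE₂≢faceE₄ s' s (trans (sym b) a))
        same (inj₂ (inj₂ (inj₂ a))) (inj₂ (inj₂ (inj₁ b))) = ⊥-elim (hor≢ver (trans (sym b) a))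
        same (inj₂ (inj₂ (inj₂ a))) (inj₂ (inj₂ (inj₂ b))) = ver-injective (trans (sym a) b)

    private
      U : EdgeSet N K
      U = faceUnion R rungFaces

      select : ∀ i j → X (toℕ j) ≡ true → vertical T (ver i j) ≡ true → selected (i , j) ≡ true
      select i j x v = cong₂ _∧_ x v

      in-union : ∀ f e → selected f ≡ true → inFace R f e ≡ true → U e ≡ true
      in-union f e s = faceUnion⁺ R e (∈rungFaces⁺ f s)

    union-hor : ∀ i j → U (hor i j) ≡ X (toℕ j)
    union-hor i j = true-iff⇒≡ covered rung
      where
        covered : U (hor i j) ≡ true → X (toℕ j) ≡ true
        covered u with faceUnion⁻ R rungFaces (hor i j) u
        ... | (i' , j') , m , p with selected-split i' j' (∈rungFaces⁻ (i' , j') m) | inFace⇒boundary R (i' , j') (hor i j) p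
        ...   | x , _ | inj₁ a = trans (cong (X ∘ toℕ ∘ proj₂) (hor-injective a)) x
        ...   | _ | inj₂ (inj₁ a) = ⊥-elim (hor≢ver a)
        ...   | x , _ | inj₂ (inj₂ (inj₁ a)) =
          trans (periodic-along periodic R-periodic (sym (hor-injective a))) x
        ...   | _ | inj₂ (inj₂ (inj₂ a)) = ⊥-elim (hor≢ver a)
        rung : X (toℕ j) ≡ true → U (hor i j) ≡ true
        rung x with vertical T (ver i j) in v
        ... | true = in-union (i , j) (hor i j) (select i j x v) (inFace-faceE₁ R (i , j))
        ... | false with vEnd-surjective R i j
        ...   | (i' , j') , ends = in-union (i' , j') (hor i j) (select i' j' x' v')
                  (subst (λ e → inFace R (i' , j') e ≡ true) (cong (λ w → hor (proj₁ w) (proj₂ w)) ends)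
                         (inFace-faceE₃ R (i' , j')))
          where
            x' = trans (sym (periodic-along periodic R-periodic ends)) x
            v' = trans (sym (not-involutive _)) (cong not (trans (sym (vertical-alternates tw ends)) v))

    union-ver : ∀ i j → U (ver i j) ≡ vertical T (ver i j) ∧ (X (toℕ j) ∨ X (toℕ j + k))
    union-ver i j = true-iff⇒≡ covered rung
      where
        covered : U (ver i j) ≡ true → vertical T (ver i j) ∧ (X (toℕ j) ∨ X (toℕ j + k)) ≡ true
        covered u with faceUnion⁻ R rungFaces (ver i j) u
        ... | (i' , j') , m , p with selected-split i' j' (∈rungFaces⁻ (i' , j') m) | inFace⇒boundary R (i' , j') (ver i j) p
        ...   | _ | inj₁ a = ⊥-elim (hor≢ver (sym a))
        ...   | x , v | inj₂ (inj₁ a) with ver-injective a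
        ...     | refl = cong₂ _∧_ (trans (vertical-steady i' j' x) v) (∨-introʳ _ (trans (periodic-pred periodic j') x))
        covered u | _ | _ , _ | inj₂ (inj₂ (inj₁ a)) = ⊥-elim (hor≢ver (sym a))
        covered u | _ | x , v | inj₂ (inj₂ (inj₂ a)) with ver-injective a
        ...     | refl = cong₂ _∧_ v (∨-introˡ _ x)
        rung : vertical T (ver i j) ∧ (X (toℕ j) ∨ X (toℕ j + k)) ≡ true → U (ver i j) ≡ true
        rung r with ∧-true {vertical T (ver i j)} r
        ... | v , y with ∨-true y
        ...   | inj₁ x = in-union (i , j) (ver i j) (select i j x v) (inFace-faceE₄ R (i , j))
        ...   | inj₂ x' with addMod-surjective j 1
        ...     | j' , refl =
          in-union (i , j') (ver i j) (select i j' x (trans (sym (vertical-steady i j' x)) v)) (inFace-faceE₂ R (i , j'))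
          where x = trans (sym (periodic-pred periodic j')) x'

    vertical⇝withRungs : Reaches R (vertical T) (withRungs X T)
    vertical⇝withRungs =
      reaches-trans R (flipAll R (vertical T) rungFaces unique alternatings disjoint) (≗ₑ⇒reaches R after-flips)
      where
        unique = filter⁺ (T? ∘ selected) (cartesianProduct⁺ (allFin⁺ N) (allFin⁺ K))
        alternatings = All.tabulate λ {f} m → alternating f (∈rungFaces⁻ f m)
        after-flips : ∀ e → vertical T e xor U e ≡ withRungs X T e
        after-flips (hor i j) = union-hor i j
        after-flips (ver i j) =
          trans (cong (vertical T (ver i j) xor_) (union-ver i j)) (xor-∧ (vertical T (ver i j)) (X (toℕ j) ∨ X (toℕ j + k)))

  toggled : (X T : ℕ → Bool) → ℕ → Bool
  toggled X T x = T x xor (X x ∨ X (x + k))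

  module _ {X : ℕ → Bool} {P : ℕ} (X-per : Periodic P X) where

    neighbours-periodic : Periodic P (λ x → X x ∨ X (x + k))
    neighbours-periodic x = cong₂ _∨_ (X-per x) (trans (cong X shift-comm) (X-per (x + k)))
      where
        shift-comm : x + P + k ≡ x + k + P
        shift-comm = trans (+-assoc x P k) (trans (cong (x +_) (+-comm P k)) (sym (+-assoc x k P)))

    toggled-periodic : ∀ {T} → Periodic P T → Periodic P (toggled X T)
    toggled-periodic T-per x = cong₂ _xor_ (T-per x) (neighbours-periodic x)

    toggled-antiperiodic : ∀ {T} → Antiperiodic P T → Antiperiodic P (toggled X T)
    toggled-antiperiodic {T} T-anti x =
      trans (cong₂ _xor_ (T-anti x) (neighbours-periodic x)) (sym (not-distribˡ-xor (T x) _))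

  module _ {T X : ℕ → Bool} (tw : Twisted T) (adm : Admissible T X) where
    open Admissible adm

    toggled-twisted : Twisted (toggled X T)
    toggled-twisted = record
      { periodic = toggled-periodic periodic (Twisted.periodic tw)
      ; antiperiodic = toggled-antiperiodic R-periodic (Twisted.antiperiodic tw)
      }

    toggled-admissible : Admissible (toggled X T) X
    toggled-admissible = record
      { periodic = periodic ; R-periodic = R-periodic ; sparse = sparse
      ; T-steady = λ x x-marked → cong₂ _xor_ (T-steady x x-marked)
                     (trans (∨-introˡ _ x-marked)
                            (sym (∨-introʳ _ (trans (cong X (sym (+-suc x k))) (trans (periodic x) x-marked)))))
      }

    withRungs-toggled : withRungs X T ≗ₑ withRungs X (toggled X T)
    withRungs-toggled (hor i j) = refl
    withRungs-toggled (ver i j) =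
      trans (sym (xor-∧-not (isEven (toℕ i) xor T (toℕ j)) (X (toℕ j) ∨ X (toℕ j + k))))
            (cong (_∧ not (X (toℕ j) ∨ X (toℕ j + k))) (xor-assoc (isEven (toℕ i)) (T (toℕ j)) _))

    toggle : Reaches R (vertical T) (vertical (toggled X T))
    toggle = reaches-trans R (Rungs.vertical⇝withRungs tw adm)
               (reaches-respˡ R withRungs-toggled (reaches-sym R (Rungs.vertical⇝withRungs toggled-twisted toggled-admissible)))

  module _ (K-even : isEven K ≡ true) (R-even : isEven R ≡ true) {T : ℕ → Bool} (tw : Twisted T) where

    alternate-rungs : ∀ {X} → Alternates X → (∀ x → X x ≡ true → T x ≡ T (suc x)) →
                      Reaches R (vertical T) (withRungs X T)
    alternate-rungs alt steady = Rungs.vertical⇝withRungs tw record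
      { periodic = alternates-periodic alt K-even
      ; R-periodic = alternates-periodic alt R-even
      ; sparse = λ x x-marked → trans (alt x) (cong not x-marked)
      ; T-steady = steady
      }

    no-verticals : ∀ {X} → Alternates X → ∀ i j → withRungs X T (ver i j) ≡ false
    no-verticals {X} alt i j = begin
      vertical T (ver i j) ∧ not (X (toℕ j) ∨ X (toℕ j + k))
        ≡⟨ cong (λ b → vertical T (ver i j) ∧ not (X (toℕ j) ∨ b)) left-neighbour ⟩
      vertical T (ver i j) ∧ not (X (toℕ j) ∨ not (X (toℕ j)))
        ≡⟨ cong (λ b → vertical T (ver i j) ∧ not b) (∨-inverseʳ (X (toℕ j))) ⟩
      vertical T (ver i j) ∧ false                                ≡⟨ ∧-zeroʳ _ ⟩
      false                                                       ∎
      where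
        open ≡-Reasoning
        left-neighbour : X (toℕ j + k) ≡ not (X (toℕ j))
        left-neighbour = trans (alternates-shift alt (toℕ j) k) (trans (cong (X (toℕ j) xor_) K-even) (xor-true (X (toℕ j))))

    even-steady⇒M₁ : (∀ x → isEven x ≡ true → T x ≡ T (suc x)) → Reaches R (vertical T) M₁
    even-steady⇒M₁ steady = reaches-trans R (alternate-rungs {isEven} (λ _ → refl) steady) (≗ₑ⇒reaches R same)
      where
        same : withRungs isEven T ≗ₑ M₁
        same (hor i j) = refl
        same (ver i j) = no-verticals {isEven} (λ _ → refl) i j

    odd-steady⇒M₂ : (∀ x → odd x ≡ true → T x ≡ T (suc x)) → Reaches R (vertical T) M₂
    odd-steady⇒M₂ steady = reaches-trans R (alternate-rungs {odd} (λ _ → refl) steady) (≗ₑ⇒reaches R same)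
      where
        same : withRungs odd T ≗ₑ M₂
        same (hor i j) = refl
        same (ver i j) = no-verticals {odd} (λ _ → refl) i j

module _ {n k R : ℕ} (n-even : isEven n ≡ true) (n≢0 : n ≢ 0) {M : EdgeSet (suc n) (suc k)}
         (perfect : IsPerfectMatching R M) (only-vertical : OnlyVertical M) where

  open Torus n k R n-even

  matching-alternates : ∀ {i' j' i j} → vEnd R i' j' ≡ (i , j) → ver i' j' ≢ ver i j →
                        M (ver i j) ≡ not (M (ver i' j'))
  matching-alternates {i'} {j'} {i} {j} ends distinct with perfect (i , j)
  ... | e , e∈M , incident , unique with M (ver i j) in here | M (ver i' j') in there
  ...   | true  | false = refl
  ...   | false | true  = refl
  ...   | true  | true  = ⊥-elim (distinct (trans (unique _ there (inj₂ (sym ends))) (sym (unique _ here (inj₁ refl)))))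
  ...   | false | false = ⊥-elim (uncovered e e∈M incident)
    where
      uncovered : ∀ e → M e ≡ true → Incident R (i , j) e → ⊥
      uncovered (hor a b) e∈M _ = true≢false (trans (sym e∈M) (only-vertical a b))
      uncovered (ver a b) e∈M (inj₁ refl) = true≢false (trans (sym e∈M) here)
      uncovered (ver a b) e∈M (inj₂ ends') with vEnd-injective R (trans (sym ends') (sym ends))
      ... | refl = true≢false (trans (sym e∈M) there)

  column-parity : ∀ a (i : Fin (suc n)) j → toℕ i ≡ a → M (ver i j) ≡ isEven a xor not (M (ver zero j))
  column-parity zero zero j _ = sym (not-involutive (M (ver zero j)))
  column-parity (suc a) (suc i) j i≡a = begin
    M (ver (suc i) j)                                    ≡⟨ matching-alternates (vEnd-inject₁ R i j) distinct ⟩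
    not (M (ver (inject₁ i) j))
      ≡⟨ cong not (column-parity a (inject₁ i) j (trans (FinP.toℕ-inject₁ i) (suc-injective i≡a))) ⟩
    not (isEven a xor not (M (ver zero j)))              ≡⟨ not-distribˡ-xor (isEven a) _ ⟩
    isEven (suc a) xor not (M (ver zero j))              ∎
    where
      open ≡-Reasoning
      distinct : ver (inject₁ i) j ≢ ver (suc i) j
      distinct eq = 1+n≢n (sym (trans (sym (FinP.toℕ-inject₁ i)) (cong (toℕ ∘ proj₁) (ver-injective eq))))

  profile : ℕ → Bool
  profile x = not (M (ver zero (x mod suc k)))

  mod-toℕ : ∀ (j : Fin (suc k)) → toℕ j mod suc k ≡ j
  mod-toℕ j = FinP.toℕ-injective (trans (FinP.toℕ-fromℕ< (m%n<n (toℕ j) (suc k))) (m<n⇒m%n≡m (FinP.toℕ<n j)))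

  matching-vertical : M ≗ₑ vertical profile
  matching-vertical (hor i j) = only-vertical i j
  matching-vertical (ver i j) =
    trans (column-parity (toℕ i) i j refl) (cong (λ j' → isEven (toℕ i) xor not (M (ver zero j'))) (sym (mod-toℕ j)))

  profile-twisted : Twisted profile
  profile-twisted = record { periodic = periodic ; antiperiodic = antiperiodic }
    where
      periodic : Periodic (suc k) profile
      periodic x = cong (λ j → not (M (ver zero j))) (FinP.toℕ-injective (begin
        toℕ ((x + suc k) mod suc k)   ≡⟨ FinP.toℕ-fromℕ< (m%n<n (x + suc k) (suc k)) ⟩
        (x + suc k) % suc k           ≡⟨ [m+n]%n≡m%n x (suc k) ⟩
        x % suc k                     ≡⟨ FinP.toℕ-fromℕ< (m%n<n x (suc k)) ⟨
        toℕ (x mod suc k)             ∎))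
        where open ≡-Reasoning
      antiperiodic : Antiperiodic R profile
      antiperiodic x = begin
        not (M (ver zero ((x + R) mod suc k)))          ≡⟨ cong (λ j' → not (M (ver zero j'))) wrap-column ⟩
        not (M (ver zero (addMod j R)))                 ≡⟨ cong not (matching-alternates (vEnd-fromℕ R j) distinct) ⟩
        not (not (M (ver (fromℕ n) j)))                 ≡⟨ not-involutive _ ⟩
        M (ver (fromℕ n) j)                             ≡⟨ column-parity n (fromℕ n) j (FinP.toℕ-fromℕ n) ⟩
        isEven n xor not (M (ver zero j))               ≡⟨ cong (_xor not (M (ver zero j))) n-even ⟩
        not (profile x)                                 ∎
        where
          open ≡-Reasoning
          j = x mod suc k
          wrap-column : (x + R) mod suc k ≡ addMod j R
          wrap-column = FinP.toℕ-injective (begin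
            toℕ ((x + R) mod suc k)        ≡⟨ FinP.toℕ-fromℕ< (m%n<n (x + R) (suc k)) ⟩
            (x + R) % suc k                ≡⟨ %-absorbˡ x R (suc k) ⟨
            (x % suc k + R) % suc k        ≡⟨ cong (λ y → (y + R) % suc k) (FinP.toℕ-fromℕ< (m%n<n x (suc k))) ⟨
            (toℕ j + R) % suc k            ≡⟨ toℕ-addMod j R ⟨
            toℕ (addMod j R)               ∎)
          distinct : ver (fromℕ n) j ≢ ver zero (addMod j R)
          distinct eq = n≢0 (trans (sym (FinP.toℕ-fromℕ n)) (cong (toℕ ∘ proj₁) (ver-injective eq)))

-- Lifting puzzle moves to flips

module Lift (n k R h a b : ℕ) (n-even : isEven n ≡ true)
            (k≡ : k ≡ Puzzle.last h + a * Puzzle.g h) (R≡ : R ≡ b * Puzzle.g h) where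

  open Torus n k R n-even
  open Puzzle h

  record Good (T : ℕ → Bool) : Set where
    field
      twisted        : Twisted T
      g-antiperiodic : Antiperiodic g T

  column : ℕ → ℕ → Bool
  column c x = x % g ≡ᵇ c

  private
    K≡ : suc k ≡ suc a * g
    K≡ = cong suc k≡

    column-periodic : ∀ c {P} q → P ≡ q * g → Periodic P (column c)
    column-periodic c q refl x = cong (_≡ᵇ c) ([m+kn]%n≡m%n x q g)

    window-pred : ℕ → ℕ
    window-pred zero = last
    window-pred (suc y) = y

    %-window-pred : ∀ x → x < g → (x + k) % g ≡ window-pred x
    %-window-pred zero _ = trans (cong (_% g) k≡) (trans ([m+kn]%n≡m%n last a g) (m<n⇒m%n≡m ≤-refl))
    %-window-pred (suc y) y<g = trans (cong (_% g) (sym (+-suc y k))) (trans (cong (λ P → (y + P) % g) K≡)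
                                  (trans ([m+kn]%n≡m%n y (suc a) g) (m<n⇒m%n≡m (<-trans (n<1+n y) y<g))))

  column-admissible : ∀ {T} c → Good T → c < g → T c ≡ T (suc c) → Admissible T (column c)
  column-admissible {T} c good c<g steady = record
    { periodic = column-periodic c (suc a) K≡
    ; R-periodic = column-periodic c b R≡
    ; sparse = λ x x∈c → ≢⇒≡ᵇ-false (next-column x (≡ᵇ-true _ _ x∈c))
    ; T-steady = λ x x∈c → T-steady x (≡ᵇ-true _ _ x∈c)
    }
    where
      open Good good
      next-column : ∀ x → x % g ≡ c → suc x % g ≢ c
      next-column x x%g≡c = subst (_≢ c) (begin
        (c + 1) % g           ≡⟨ cong (λ y → (y + 1) % g) x%g≡c ⟨
        (x % g + 1) % g       ≡⟨ %-absorbˡ x 1 g ⟩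
        (x + 1) % g           ≡⟨ cong (_% g) (+-comm x 1) ⟩
        suc x % g             ∎) (step (m≤n⇒m<n∨m≡n c<g))
        where
          open ≡-Reasoning
          step : suc c < g ⊎ suc c ≡ g → (c + 1) % g ≢ c
          step (inj₁ c+1<g) eq = 1+n≢n (trans (trans (sym (+-comm c 1)) (sym (m<n⇒m%n≡m (subst (_< g) (+-comm 1 c) c+1<g)))) eq)
          step (inj₂ refl) eq = 0≢1+n (trans (sym (n%n≡0 g)) (trans (cong (_% g) (+-comm 1 c)) eq))
      T-steady : ∀ x → x % g ≡ c → T x ≡ T (suc x)
      T-steady x x%g≡c = begin
        T x                                  ≡⟨ antiperiodic-split g-antiperiodic 0 x ⟩
        T (x % g) xor odd (x / g)            ≡⟨ cong (λ y → T y xor odd (x / g)) x%g≡c ⟩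
        T c xor odd (x / g)                  ≡⟨ cong (_xor odd (x / g)) steady ⟩
        T (suc c) xor odd (x / g)            ≡⟨ cong (λ y → T (suc y) xor odd (x / g)) x%g≡c ⟨
        T (suc (x % g)) xor odd (x / g)      ≡⟨ antiperiodic-split g-antiperiodic 1 x ⟨
        T (suc x)                            ∎
        where open ≡-Reasoning

  -- with ψ = T xor parity, toggling two equal neighbours of T exchanges two unequal neighbours of ψ
  Represents : (ψ T : ℕ → Bool) → Set
  Represents ψ T = ∀ x → x < g → T x ≡ ψ x xor odd x

  represents-flips : ∀ {ψ T T' c c'} → Represents ψ T → (∀ x → x < g → T' x ≡ flipAt c (flipAt c' T) x) →
                     Represents (flipAt c (flipAt c' ψ)) T'
  represents-flips {ψ} {T} {T'} {c} {c'} rep T'≡ x x<g = begin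
    T' x                                                ≡⟨ T'≡ x x<g ⟩
    (T x xor (x ≡ᵇ c')) xor (x ≡ᵇ c)
      ≡⟨ cong (λ y → (y xor (x ≡ᵇ c')) xor (x ≡ᵇ c)) (rep x x<g) ⟩
    ((ψ x xor odd x) xor (x ≡ᵇ c')) xor (x ≡ᵇ c)
      ≡⟨ cong (_xor (x ≡ᵇ c)) (xor-swapʳ (ψ x) (odd x) (x ≡ᵇ c')) ⟩
    ((ψ x xor (x ≡ᵇ c')) xor odd x) xor (x ≡ᵇ c)       ≡⟨ xor-swapʳ (ψ x xor (x ≡ᵇ c')) (odd x) (x ≡ᵇ c) ⟩
    ((ψ x xor (x ≡ᵇ c')) xor (x ≡ᵇ c)) xor odd x       ∎
    where open ≡-Reasoning

  toggled-window : ∀ {T} c c' → c ≢ c' → (∀ x → x < g → (window-pred x ≡ᵇ c) ≡ (x ≡ᵇ c')) →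
                   ∀ x → x < g → toggled (column c) T x ≡ flipAt c' (flipAt c T) x
  toggled-window {T} c c' c≢c' successor x x<g = begin
    T x xor ((x % g ≡ᵇ c) ∨ ((x + k) % g ≡ᵇ c))
      ≡⟨ cong₂ (λ y z → T x xor ((y ≡ᵇ c) ∨ (z ≡ᵇ c))) (m<n⇒m%n≡m x<g) (%-window-pred x x<g) ⟩
    T x xor ((x ≡ᵇ c) ∨ (window-pred x ≡ᵇ c))    ≡⟨ cong (λ y → T x xor ((x ≡ᵇ c) ∨ y)) (successor x x<g) ⟩
    T x xor ((x ≡ᵇ c) ∨ (x ≡ᵇ c'))
      ≡⟨ xor-∨-disjoint (T x) _ _ (λ p q → c≢c' (trans (sym (≡ᵇ-true x c p)) (≡ᵇ-true x c' q))) ⟨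
    (T x xor (x ≡ᵇ c)) xor (x ≡ᵇ c')             ∎
    where open ≡-Reasoning

  record Step (T : ℕ → Bool) (c c' : ℕ) : Set where
    field
      next         : ℕ → Bool
      next-good    : Good next
      reaches-next : Reaches R (vertical T) (vertical next)
      next-window  : ∀ x → x < g → next x ≡ flipAt c' (flipAt c T) x

  toggle-column : ∀ {T} c c' → Good T → c < g → T c ≡ T (suc c) → c ≢ c' →
                  (∀ x → x < g → (window-pred x ≡ᵇ c) ≡ (x ≡ᵇ c')) → Step T c c'
  toggle-column {T} c c' good c<g steady c≢c' successor = record
    { next = toggled (column c) T
    ; next-good = record
      { twisted = toggled-twisted (Good.twisted good) admissible
      ; g-antiperiodic = toggled-antiperiodic (column-periodic c 1 (sym (*-identityˡ g))) (Good.g-antiperiodic good)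
      }
    ; reaches-next = toggle (Good.twisted good) admissible
    ; next-window = toggled-window {T} c c' c≢c' successor
    }
    where admissible = column-admissible c good c<g steady

  record Normalisable (T : ℕ → Bool) : Set where
    field
      normal         : ℕ → Bool
      normal-good    : Good normal
      reaches-normal : Reaches R (vertical T) (vertical normal)
      normal-window  : ∀ x → x < last → normal x ≡ false

  prepend : ∀ {T T'} → Reaches R (vertical T) (vertical T') → Normalisable T' → Normalisable T
  prepend r nf = record { Normalisable nf ; reaches-normal = reaches-trans R r (Normalisable.reaches-normal nf) }

  lift : ∀ {ψ} → Solvable ψ → ∀ {T} → Good T → Represents ψ T → Normalisable T
  lift (solved sol) {T} good rep = record
    { normal = T ; normal-good = good ; reaches-normal = reaches-refl R
    ; normal-window = λ x x<last → trans (rep x (<-trans x<last (n<1+n last)))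
                                    (trans (cong (_xor odd x) (sol x x<last)) (xor-same (odd x)))
    }
  lift (swap {ψ} c c+1<g ψc≢ψc+1 s) {T} good rep =
    prepend (Step.reaches-next step) (lift s (Step.next-good step) (represents-flips {ψ} rep window))
    where
      steady : T c ≡ T (suc c)
      steady = begin
        T c                                  ≡⟨ rep c (<-trans (n<1+n c) c+1<g) ⟩
        ψ c xor odd c                        ≡⟨ xor-annihilates-not (ψ c) (odd c) ⟨
        not (ψ c) xor odd (suc c)            ≡⟨ cong (_xor odd (suc c)) (¬-not (≢-sym ψc≢ψc+1)) ⟨
        ψ (suc c) xor odd (suc c)            ≡⟨ rep (suc c) c+1<g ⟨
        T (suc c)                            ∎
        where open ≡-Reasoning
      successor : ∀ x → x < g → (window-pred x ≡ᵇ c) ≡ (x ≡ᵇ suc c)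
      successor zero _ = ≢⇒≡ᵇ-false (≢-sym (<⇒≢ (s≤s⁻¹ c+1<g)))
      successor (suc y) _ = refl
      step = toggle-column c (suc c) good (<-trans (n<1+n c) c+1<g) steady (<⇒≢ (n<1+n c)) successor
      window : ∀ x → x < g → Step.next step x ≡ flipAt c (flipAt (suc c) T) x
      window x x<g = trans (Step.next-window step x x<g) (flipAt-comm (suc c) c T x)
  lift (wrap {ψ} ψlast≡ψ0 s) {T} good rep =
    prepend (Step.reaches-next step) (lift s (Step.next-good step) (represents-flips {ψ} rep (Step.next-window step)))
    where
      steady : T last ≡ T (suc last)
      steady = begin
        T last                               ≡⟨ rep last ≤-refl ⟩
        ψ last xor odd last                  ≡⟨ cong₂ _xor_ ψlast≡ψ0 odd-last ⟩
        ψ 0 xor true                         ≡⟨ xor-true (ψ 0) ⟩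
        not (ψ 0)                            ≡⟨ cong not (xor-identityʳ (ψ 0)) ⟨
        not (ψ 0 xor odd 0)                  ≡⟨ cong not (rep 0 (s≤s z≤n)) ⟨
        not (T 0)                            ≡⟨ Good.g-antiperiodic good 0 ⟨
        T (suc last)                         ∎
        where open ≡-Reasoning
      successor : ∀ x → x < g → (window-pred x ≡ᵇ last) ≡ (x ≡ᵇ 0)
      successor zero _ = ≡ᵇ-refl last
      successor (suc y) y<g = ≢⇒≡ᵇ-false (<⇒≢ (s≤s⁻¹ y<g))
      step = toggle-column last 0 good ≤-refl steady (λ ()) successor
  lift (agree same s) good rep = lift s good λ x x<g → trans (rep x x<g) (cong (_xor odd x) (same x x<g))

  private
    g-even : isEven g ≡ true
    g-even = trans (not-involutive _) (isEven-double h)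

    isEven-multiple : ∀ q → isEven (q * g) ≡ true
    isEven-multiple q = periodic-iterate (alternates-periodic {isEven} (λ _ → refl) g-even) 0 q

    isEven-%g : ∀ x → isEven (x % g) ≡ isEven x
    isEven-%g x = sym (trans (cong isEven (m≡m%n+[m/n]*n x g))
                    (periodic-iterate (alternates-periodic {isEven} (λ _ → refl) g-even) (x % g) (x / g)))

    K-even : isEven (suc k) ≡ true
    K-even = trans (cong isEven K≡) (isEven-multiple (suc a))

    R-even : isEven R ≡ true
    R-even = trans (cong isEven R≡) (isEven-multiple b)

    last-odd : isEven last ≡ false
    last-odd = cong not (isEven-double h)

  steady-via-window : ∀ {T} → Good T → ∀ x → T (x % g) ≡ T (suc (x % g)) → T x ≡ T (suc x)
  steady-via-window {T} good x eq =
    trans (antiperiodic-split anti 0 x) (trans (cong (_xor odd (x / g)) eq) (sym (antiperiodic-split anti 1 x)))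
    where anti = Good.g-antiperiodic good

  normal-form : ∀ {T} → Good T → (∀ x → x < last → T x ≡ false) →
                Reaches R (vertical T) M₁ ⊎ Reaches R (vertical T) M₂
  normal-form {T} good below with T last in T-last
  ... | false = inj₁ (even-steady⇒M₁ K-even R-even (Good.twisted good) steady)
    where
      steady : ∀ x → isEven x ≡ true → T x ≡ T (suc x)
      steady x x-even = steady-via-window good x (trans (below r r<last) (sym next))
        where
          r = x % g
          r<last : r < last
          r<last = ≤∧≢⇒< (s≤s⁻¹ (m%n<n x g)) λ r≡last →
            true≢false (trans (sym (trans (isEven-%g x) x-even)) (trans (cong isEven r≡last) last-odd))
          next : T (suc r) ≡ false
          next with m≤n⇒m<n∨m≡n r<last
          ... | inj₁ r+1<last = below (suc r) r+1<last
          ... | inj₂ r+1≡last = trans (cong T r+1≡last) T-last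
  ... | true = inj₂ (odd-steady⇒M₂ K-even R-even (Good.twisted good) steady)
    where
      steady : ∀ x → odd x ≡ true → T x ≡ T (suc x)
      steady x x-odd with m≤n⇒m<n∨m≡n (s≤s⁻¹ (m%n<n x g))
      ... | inj₁ r<last = steady-via-window good x (trans (below r r<last) (sym (below (suc r) r+1<last)))
        where
          r = x % g
          r-odd : isEven r ≡ false
          r-odd = trans (isEven-%g x) (trans (sym (not-involutive (isEven x))) (cong not x-odd))
          r+1<last : suc r < last
          r+1<last = ≤∧≢⇒< r<last λ r+1≡last →
            true≢false (trans (sym (isEven-double h)) (trans (cong isEven (sym (suc-injective r+1≡last))) r-odd))
      ... | inj₂ r≡last =
        steady-via-window good x (trans (trans (cong T r≡last) T-last) (sym (trans (cong (T ∘ suc) r≡last) wrap-around)))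
        where
          wrap-around : T (suc last) ≡ true
          wrap-around = trans (Good.g-antiperiodic good 0) (cong not (below 0 (s≤s z≤n)))

module _ {n k R h a b x y : ℕ} (n-even : isEven n ≡ true) (n≢0 : n ≢ 0)
         (k≡ : k ≡ Puzzle.last h + a * Puzzle.g h) (R≡ : R ≡ b * Puzzle.g h)
         (bezout : Puzzle.g h + y * R ≡ x * suc k ⊎ Puzzle.g h + x * suc k ≡ y * R) where

  open Torus n k R n-even
  open Puzzle h
  open Lift n k R h a b n-even k≡ R≡

  vertical-reaches-M₁⊎M₂ : ∀ {M : EdgeSet (suc n) (suc k)} → IsPerfectMatching R M → OnlyVertical M →
                            Reaches R M M₁ ⊎ Reaches R M M₂
  vertical-reaches-M₁⊎M₂ {M} perfect only-vertical =
    Sum.map onward onward (normal-form normal-good normal-window)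
    where
      twisted = profile-twisted n-even n≢0 perfect only-vertical
      T = profile n-even n≢0 perfect only-vertical
      good : Good T
      good = record
        { twisted = twisted
        ; g-antiperiodic =
            antiperiodic-gcd {b = b} {x} {y} (Twisted.periodic twisted) (Twisted.antiperiodic twisted) R≡ bezout
        }
      open Normalisable (lift (solvable (λ x → T x xor odd x)) good λ x _ → sym (xor-cancelʳ (T x) (odd x)))
      onward : ∀ {M'} → Reaches R (vertical normal) M' → Reaches R M M'
      onward r = reaches-respˡ R (matching-vertical n-even n≢0 perfect only-vertical) (reaches-trans R reaches-normal r)

private
  isEven-2* : ∀ x → isEven (2 * x) ≡ true
  isEven-2* x = trans (cong (λ y → isEven (x + y)) (+-identityʳ x)) (isEven-double x)

  double-last : ∀ a h → 2 * (suc a * suc h) ≡ suc (suc (h + h)) + a * suc (suc (h + h))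
  double-last = solve-∀

  double-multiple : ∀ b h → 2 * (b * suc h) ≡ b * suc (suc (h + h))
  double-multiple = solve-∀

  double-gcd : ∀ h y r → suc (suc (h + h)) + y * (2 * r) ≡ 2 * (suc h + y * r)
  double-gcd = solve-∀

  double-product : ∀ x m → 2 * (x * m) ≡ x * (2 * m)
  double-product = solve-∀

torus-reaches : ∀ n m r (M : EdgeSet (suc (2 * suc n)) (2 * suc m)) →
                IsPerfectMatching (2 * suc r) M → OnlyVertical M →
                Reaches (2 * suc r) M M₁ ⊎ Reaches (2 * suc r) M M₂
torus-reaches n m r M perfect only-vertical =
  via (gcd (suc m) (suc r)) (gcd[m,n]≢0 (suc m) (suc r) (inj₁ λ ()))
      (_∣_.quotient m∣) (_∣_.equality m∣) (_∣_.quotient r∣) (_∣_.equality r∣)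
      (Bézout.identity (gcd-GCD (suc m) (suc r)))
  where
    m∣ = gcd[m,n]∣m (suc m) (suc r)
    r∣ = gcd[m,n]∣n (suc m) (suc r)
    via : ∀ d → d ≢ 0 → ∀ a → suc m ≡ a * d → ∀ b → suc r ≡ b * d → Bézout.Identity d (suc m) (suc r) →
          Reaches (2 * suc r) M M₁ ⊎ Reaches (2 * suc r) M M₂
    via zero d≢0 _ _ _ _ _ = ⊥-elim (d≢0 refl)
    via (suc h) _ zero m≡ _ _ _ = ⊥-elim (0≢1+n (sym (trans m≡ (*-zeroˡ (suc h)))))
    via (suc h) _ (suc a) m≡ b r≡ identity = go identity
      where
        k≡ : pred (2 * suc m) ≡ suc (h + h) + a * suc (suc (h + h))
        k≡ = suc-injective (trans (cong (2 *_) m≡) (double-last a h))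
        R≡ : 2 * suc r ≡ b * suc (suc (h + h))
        R≡ = trans (cong (2 *_) r≡) (double-multiple b h)
        go : Bézout.Identity (suc h) (suc m) (suc r) → Reaches (2 * suc r) M M₁ ⊎ Reaches (2 * suc r) M M₂
        go (Bézout.+- x y eq) = vertical-reaches-M₁⊎M₂ {h = h} {a} {b} {x} {y} (isEven-2* (suc n)) (λ ()) k≡ R≡
          (inj₁ (trans (double-gcd h y (suc r)) (trans (cong (2 *_) eq) (double-product x (suc m))))) perfect only-vertical
        go (Bézout.-+ x y eq) = vertical-reaches-M₁⊎M₂ {h = h} {a} {b} {x} {y} (isEven-2* (suc n)) (λ ()) k≡ R≡
          (inj₂ (trans (double-gcd h x (suc m)) (trans (cong (2 *_) eq) (double-product y (suc r))))) perfect only-vertical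

lemma3p5 : (n m r : ℕ) → 1 ≤ n → 2 ≤ m → 1 ≤ r → r ≤ m →
    (M : EdgeSet (suc (2 * n)) (2 * m)) →
    IsPerfectMatching (2 * r) M → OnlyVertical M →
    Σ (EdgeSet (suc (2 * n)) (2 * m)) λ M' →
      FlipReachable (2 * r) M M' × ((M' ≗ₑ M₁) ⊎ (M' ≗ₑ M₂))
lemma3p5 zero _ _ () _ _ _ _ _ _
lemma3p5 (suc n) zero _ _ () _ _ _ _ _
lemma3p5 (suc n) (suc m) zero _ _ () _ _ _ _
lemma3p5 (suc n) (suc m) (suc r) _ _ _ _ M perfect only-vertical with torus-reaches n m r M perfect only-vertical
... | inj₁ (M' , steps , M'≗M₁) = M' , steps , inj₁ M'≗M₁
... | inj₂ (M' , steps , M'≗M₂) = M' , steps , inj₂ M'≗M₂
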